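{- Let $q=p^h$ with $p$ prime, let $t$ be a prime divisor of $q^2+q+1$, $d=(q^2+q+1)/t$, and let $w_0,\dots,w_{t-1}$ and $O_0,\dots,O_{t-1}$ be as in the context. Let $O_{i_1},\dots,O_{i_{s(p,t)}}$ be representatives of the orbits of the cyclic group generated by $\tau$ acting on $\{O_1,\dots,O_{t-1}\}$. Then $$w_0+\frac{t-1}{s(p,t)}\sum_{j=1}^{s(p,t)}w_{i_j}=q+1,\qquad w_0^2+\frac{t-1}{s(p,t)}\sum_{j=1}^{s(p,t)}w_{i_j}^2=\frac{q^2+(t+1)q+1}{t}.$$
   Context: Let $\alpha$ be a primitive element of $\mathbb{F}_{q^3}$; identify the points of $PG(2,q)$ with $\mathbb{F}_{q^3}^*/\mathbb{F}_q^*$ and let $P_i$ be the point represented by $\alpha^i$, $i=0,\dots,q^2+q$. For $u=0,\dots,t-1$ let $O_u=\{P_i:i\equiv u\pmod t\}$. The map $\tau:P_i\mapsto P_{ip\bmod(q^2+q+1)}$ is a collineation of $PG(2,q)$ (it maps $O_u$ to $O_{pu\bmod t}$); $\ell_0$ denotes a fixed line of $PG(2,q)$ left invariant by $\tau$, and $w_u=|\ell_0\cap O_u|$. $s(p,t)$ denotes the number of orbits of $\mathbb{Z}_t\setminus\{0\}$ under the group generated by $i\mapsto p\cdot i$. -}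

module Defs where

open import Level using (_⊔_)
open import Algebra.Bundles using (CommutativeRing)
open import Data.Bool using (Bool; true; false; _∧_; _∨_; if_then_else_)
open import Data.Nat using (ℕ; zero; suc; _+_; _*_; _∸_; _^_; _≤_; _<_; _≤?_)
open import Data.Nat using () renaming (_≟_ to _ℕ≟_)
open import Data.Nat.DivMod using (_%_)
open import Data.Fin using (Fin)
open import Data.Product using (∃; _×_)
open import Relation.Nullary using (¬_)
open import Relation.Nullary.Decidable using (⌊_⌋)
open import Relation.Binary.Definitions using (Decidable)
open import Relation.Binary.PropositionalEquality using (_≡_)

record IsFieldOfOrder {c ℓ} (F : CommutativeRing c ℓ) (n : ℕ) : Set (c ⊔ ℓ) where
  open CommutativeRing F renaming (_*_ to _·_; _+_ to _⊕_)
  field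
    _≟_       : Decidable _≈_
    1≉0       : ¬ (1# ≈ 0#)
    inverse   : ∀ x → ¬ (x ≈ 0#) → ∃ λ y → (x · y) ≈ 1#
    enum      : Fin n → Carrier
    enum-inj  : ∀ i j → enum i ≈ enum j → i ≡ j
    enum-surj : ∀ x → ∃ λ i → enum i ≈ x

module _ {c ℓ} (F : CommutativeRing c ℓ) where
  open CommutativeRing F renaming (_*_ to _·_; _+_ to _⊕_)

  pow : Carrier → ℕ → Carrier
  pow x zero    = 1#
  pow x (suc k) = x · pow x k

  IsPrimitive : ℕ → Carrier → Set ℓ
  IsPrimitive n α = ¬ (α ≈ 0#) × (∀ k → 0 < k → k < n ∸ 1 → ¬ (pow α k ≈ 1#))

  InSubfield : ℕ → Carrier → Set ℓ
  InSubfield q x = pow x q ≈ x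

anyBelow : ℕ → (ℕ → Bool) → Bool
anyBelow zero    f = false
anyBelow (suc n) f = f n ∨ anyBelow n f

allBelow : ℕ → (ℕ → Bool) → Bool
allBelow zero    f = true
allBelow (suc n) f = f n ∧ allBelow n f

count : ℕ → (ℕ → Bool) → ℕ
count zero    f = 0
count (suc n) f = (if f n then 1 else 0) + count n f

anyFin : ∀ {n} → (Fin n → Bool) → Bool
anyFin {zero}  f = false
anyFin {suc n} f = f Fin.zero ∨ anyFin (λ i → f (Fin.suc i))

finSum : ∀ {n} → (Fin n → ℕ) → ℕ
finSum {zero}  f = 0
finSum {suc n} f = f Fin.zero + finSum (λ i → f (Fin.suc i))

module _ {c ℓ} (F : CommutativeRing c ℓ) {N : ℕ} (isF : IsFieldOfOrder F N) where
  open CommutativeRing F renaming (_*_ to _·_; _+_ to _⊕_)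
  open IsFieldOfOrder isF

  isSubfieldB : ℕ → Carrier → Bool
  isSubfieldB q x = ⌊ pow F x q ≟ x ⌋

  inSpanB : ℕ → Carrier → Carrier → Carrier → Bool
  inSpanB q a b y =
    anyFin λ i → anyFin λ j →
      isSubfieldB q (enum i) ∧ isSubfieldB q (enum j) ∧
      ⌊ y ≟ ((enum i · a) ⊕ (enum j · b)) ⌋

  -- the point P_i = ⟨α^i⟩ lies on the projective line of PG(2,q)
  -- determined by the 2-dimensional F_q-subspace spanned by a, b
  onLineB : ℕ → Carrier → Carrier → Carrier → ℕ → Bool
  onLineB q α a b i = inSpanB q a b (pow F α i)

  -- w_u = | ℓ ∩ O_u |, O_u = { P_i : 0 ≤ i ≤ q²+q, i ≡ u (mod t) }
  weight : ℕ → ℕ → Carrier → Carrier → Carrier → ℕ → ℕ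
  weight q t α a b u =
    count (q * q + q + 1) λ i → onLineB q α a b i ∧ ⌊ (i % suc (t ∸ 1)) ℕ≟ u ⌋

SameOrbit : (p t : ℕ) → ℕ → ℕ → Set
SameOrbit p t u v = ∃ λ k → (v % suc (t ∸ 1)) ≡ ((u * p ^ k) % suc (t ∸ 1))

-- s(p,t): number of orbits of Z_t \ {0} under ⟨ i ↦ p·i ⟩, counted as the
-- number of u ∈ {1..t-1} that are the least element of their orbit
-- (orbits have length < t, so exponents k < t suffice)
sOrb : ℕ → ℕ → ℕ
sOrb p t = count t λ u →
  ⌊ 1 ≤? u ⌋ ∧ allBelow t (λ k → ⌊ u ≤? ((u * p ^ k) % suc (t ∸ 1)) ⌋)

module Submission where

-- Through the Singer cycle i ↦ ⟨α^i⟩ the line ℓ₀ becomes a set D ⊆ ℤ_n, n = q² + q + 1, of size at most q + 1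
-- (the q - 1 scalar multiples of its points are distinct among the q² - 1 nonzero vectors of a 2-dimensional
-- F_q-space), in which every difference δ occurs: otherwise the q⁴ elements u - α^δ v, u and v in that space,
-- would be distinct in a field with q³ elements.  Counting ordered pairs, |D|² = |D| + Σ_{δ ≠ 0} r(δ) ≥ |D| + q² + q,
-- so |D| = q + 1 and every nonzero difference occurs exactly once: D is a perfect difference set.  Hence
-- Σ_u w_u = q + 1, and Σ_u w_u² counts the pairs of D whose difference is divisible by t, namely q + 1 + (n/t - 1).
-- Finally τ maps O_u onto O_{pu}, so w is constant on the orbits of u ↦ pu on ℤ_t \ {0}, all of size the order
-- of p mod t, which is (t - 1)/s(p,t).

module FiniteSums where
  open import Data.Bool using (Bool; true; false; _∧_)
  open import Data.Nat
  open import Data.Nat.Properties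
  open import Data.Nat.DivMod
  open import Data.Product using (_×_; _,_)
  open import Data.Empty using (⊥-elim)
  open import Relation.Nullary using (yes; no)
  open import Relation.Nullary.Decidable using (⌊_⌋)
  open import Relation.Binary.PropositionalEquality
  open import Algebra.Properties.CommutativeSemigroup +-commutativeSemigroup using (interchange; x∙yz≈y∙xz)
  open ≡-Reasoning

  𝟙 : Bool → ℕ
  𝟙 true  = 1
  𝟙 false = 0

  𝟙-∧ : ∀ a b → 𝟙 (a ∧ b) ≡ 𝟙 a * 𝟙 b
  𝟙-∧ true  b = sym (+-identityʳ (𝟙 b))
  𝟙-∧ false b = refl

  𝟙-idem : ∀ a → 𝟙 a * 𝟙 a ≡ 𝟙 a
  𝟙-idem true  = refl
  𝟙-idem false = refl

  ⌊≟⌋-sym : ∀ m n → ⌊ m ≟ n ⌋ ≡ ⌊ n ≟ m ⌋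
  ⌊≟⌋-sym m n with m ≟ n | n ≟ m
  ... | yes _   | yes _   = refl
  ... | no _    | no _    = refl
  ... | yes m≡n | no n≢m  = ⊥-elim (n≢m (sym m≡n))
  ... | no m≢n  | yes n≡m = ⊥-elim (m≢n (sym n≡m))

  ⌊≟⌋-≢ : ∀ {m n} → m ≢ n → ⌊ m ≟ n ⌋ ≡ false
  ⌊≟⌋-≢ {m} {n} m≢n with m ≟ n
  ... | yes m≡n = ⊥-elim (m≢n m≡n)
  ... | no _    = refl

  ⌊≟⌋-refl : ∀ m → ⌊ m ≟ m ⌋ ≡ true
  ⌊≟⌋-refl m with m ≟ m
  ... | yes _   = refl
  ... | no m≢m = ⊥-elim (m≢m refl)

  ⌊≟⌋≡true⇒≡ : ∀ {m n} → ⌊ m ≟ n ⌋ ≡ true → m ≡ n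
  ⌊≟⌋≡true⇒≡ {m} {n} _ with m ≟ n
  ... | yes m≡n = m≡n

  ∧≡true⇒ : ∀ {x y} → x ∧ y ≡ true → x ≡ true × y ≡ true
  ∧≡true⇒ {true} {true} _ = refl , refl

  ∧≡true⇐ : ∀ {x y} → x ≡ true → y ≡ true → x ∧ y ≡ true
  ∧≡true⇐ refl refl = refl

  ≡⇒⌊≟⌋≡true : ∀ {m n} → m ≡ n → ⌊ m ≟ n ⌋ ≡ true
  ≡⇒⌊≟⌋≡true {m} refl = ⌊≟⌋-refl m

  ⌊≟⌋-injective : ∀ {a b} (f : ℕ → ℕ) → (f a ≡ f b → a ≡ b) → ⌊ f a ≟ f b ⌋ ≡ ⌊ a ≟ b ⌋
  ⌊≟⌋-injective {a} {b} f inj with a ≟ b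
  ... | yes refl = ⌊≟⌋-refl (f a)
  ... | no a≢b   = ⌊≟⌋-≢ (λ fa≡fb → a≢b (inj fa≡fb))

  sumBelow : ℕ → (ℕ → ℕ) → ℕ
  sumBelow zero    f = 0
  sumBelow (suc n) f = f n + sumBelow n f

  sumBelow-cong : ∀ n {f g} → (∀ i → i < n → f i ≡ g i) → sumBelow n f ≡ sumBelow n g
  sumBelow-cong zero    f≗g = refl
  sumBelow-cong (suc n) f≗g =
    cong₂ _+_ (f≗g n ≤-refl) (sumBelow-cong n (λ i i<n → f≗g i (m<n⇒m<1+n i<n)))

  sumBelow-distrib-+ : ∀ n f g → sumBelow n (λ i → f i + g i) ≡ sumBelow n f + sumBelow n g
  sumBelow-distrib-+ zero    f g = refl
  sumBelow-distrib-+ (suc n) f g =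
    trans (cong (f n + g n +_) (sumBelow-distrib-+ n f g)) (interchange (f n) (g n) _ _)

  sumBelow-*ˡ : ∀ n c f → sumBelow n (λ i → c * f i) ≡ c * sumBelow n f
  sumBelow-*ˡ zero    c f = sym (*-zeroʳ c)
  sumBelow-*ˡ (suc n) c f =
    trans (cong (c * f n +_) (sumBelow-*ˡ n c f)) (sym (*-distribˡ-+ c (f n) (sumBelow n f)))

  sumBelow-*ʳ : ∀ n c f → sumBelow n (λ i → f i * c) ≡ sumBelow n f * c
  sumBelow-*ʳ n c f = begin
    sumBelow n (λ i → f i * c) ≡⟨ sumBelow-cong n (λ i _ → *-comm (f i) c) ⟩
    sumBelow n (λ i → c * f i) ≡⟨ sumBelow-*ˡ n c f ⟩
    c * sumBelow n f           ≡⟨ *-comm c _ ⟩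
    sumBelow n f * c           ∎

  sumBelow-const : ∀ n c → sumBelow n (λ _ → c) ≡ n * c
  sumBelow-const zero    c = refl
  sumBelow-const (suc n) c = cong (c +_) (sumBelow-const n c)

  sumBelow-0 : ∀ n {f} → (∀ i → i < n → f i ≡ 0) → sumBelow n f ≡ 0
  sumBelow-0 n f≡0 = trans (sumBelow-cong n f≡0) (trans (sumBelow-const n 0) (*-zeroʳ n))

  sumBelow-comm : ∀ m n (f : ℕ → ℕ → ℕ) →
    sumBelow m (λ i → sumBelow n (f i)) ≡ sumBelow n (λ j → sumBelow m (λ i → f i j))
  sumBelow-comm zero    n f = sym (sumBelow-0 n (λ _ _ → refl))
  sumBelow-comm (suc m) n f = trans (cong (sumBelow n (f m) +_) (sumBelow-comm m n f))
    (sym (sumBelow-distrib-+ n (f m) (λ j → sumBelow m (λ i → f i j))))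

  sumBelow-square : ∀ n f g → sumBelow n f * sumBelow n g ≡ sumBelow n (λ x → sumBelow n (λ y → f x * g y))
  sumBelow-square n f g = begin
    sumBelow n f * sumBelow n g                  ≡⟨ sumBelow-*ʳ n (sumBelow n g) f ⟨
    sumBelow n (λ x → f x * sumBelow n g)        ≡⟨ sumBelow-cong n (λ x _ → sumBelow-*ˡ n (f x) g) ⟨
    sumBelow n (λ x → sumBelow n (λ y → f x * g y)) ∎

  sumBelow-suc : ∀ n f → sumBelow (suc n) f ≡ f 0 + sumBelow n (λ i → f (suc i))
  sumBelow-suc zero    f = refl
  sumBelow-suc (suc n) f =
    trans (cong (f (suc n) +_) (sumBelow-suc n f)) (x∙yz≈y∙xz (f (suc n)) (f 0) _)

  sumBelow-+ : ∀ m n f → sumBelow (m + n) f ≡ sumBelow n f + sumBelow m (λ i → f (n + i))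
  sumBelow-+ zero    n f = sym (+-identityʳ _)
  sumBelow-+ (suc m) n f = begin
    f (m + n) + sumBelow (m + n) f                         ≡⟨ cong₂ _+_ (cong f (+-comm m n)) (sumBelow-+ m n f) ⟩
    f (n + m) + (sumBelow n f + sumBelow m (λ i → f (n + i))) ≡⟨ x∙yz≈y∙xz (f (n + m)) (sumBelow n f) _ ⟩
    sumBelow n f + sumBelow (suc m) (λ i → f (n + i))       ∎

  sumBelow-periodic : ∀ k n {f} → (∀ i → f (n + i) ≡ f i) → sumBelow (k * n) f ≡ k * sumBelow n f
  sumBelow-periodic zero    n f-periodic = refl
  sumBelow-periodic (suc k) n {f} f-periodic = begin
    sumBelow (n + k * n) f                              ≡⟨ sumBelow-+ n (k * n) f ⟩
    sumBelow (k * n) f + sumBelow n (λ i → f (k * n + i)) ≡⟨ cong₂ _+_ (sumBelow-periodic k n f-periodic)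
                                                                       (sumBelow-cong n (λ i _ → shift k i)) ⟩
    k * sumBelow n f + sumBelow n f                     ≡⟨ +-comm (k * sumBelow n f) _ ⟩
    sumBelow n f + k * sumBelow n f                     ∎
    where
    shift : ∀ k i → f (k * n + i) ≡ f i
    shift zero    i = refl
    shift (suc k) i = trans (cong f (+-assoc n (k * n) i)) (trans (f-periodic (k * n + i)) (shift k i))

  sumBelow-mono-≤ : ∀ n {f g} → (∀ i → i < n → f i ≤ g i) → sumBelow n f ≤ sumBelow n g
  sumBelow-mono-≤ zero    f≤g = z≤n
  sumBelow-mono-≤ (suc n) f≤g =
    +-mono-≤ (f≤g n ≤-refl) (sumBelow-mono-≤ n (λ i i<n → f≤g i (m<n⇒m<1+n i<n)))

  term≤sumBelow : ∀ n f {i} → i < n → f i ≤ sumBelow n f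
  term≤sumBelow (suc n) f {i} i<1+n with i ≟ n
  ... | yes refl = m≤m+n (f i) _
  ... | no i≢n   = ≤-trans (term≤sumBelow n f (≤∧≢⇒< (≤-pred i<1+n) i≢n)) (m≤n+m _ (f n))

  sumBelow-select : ∀ n {v} (g : ℕ → ℕ) → v < n → sumBelow n (λ i → 𝟙 ⌊ i ≟ v ⌋ * g i) ≡ g v
  sumBelow-select (suc n) {v} g v<1+n with n ≟ v
  ... | yes refl = begin
    1 * g n + sumBelow n (λ i → 𝟙 ⌊ i ≟ n ⌋ * g i) ≡⟨ cong₂ _+_ (*-identityˡ (g n)) (sumBelow-0 n (λ i i<n →
                                                         cong (λ b → 𝟙 b * g i) (⌊≟⌋-≢ (<⇒≢ i<n)))) ⟩
    g n + 0                                       ≡⟨ +-identityʳ _ ⟩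
    g n                                           ∎
  ... | no n≢v = sumBelow-select n g (≤∧≢⇒< (≤-pred v<1+n) (≢-sym n≢v))

  sumBelow-rotate : ∀ n .{{_ : NonZero n}} x h → sumBelow n (λ i → h ((x + i) % n)) ≡ sumBelow n h
  sumBelow-rotate n zero    h = sumBelow-cong n (λ i i<n → cong h (m<n⇒m%n≡m i<n))
  sumBelow-rotate (suc m) (suc x) h = begin
    sumBelow (suc m) (λ i → h ((suc x + i) % suc m)) ≡⟨ sumBelow-cong (suc m) (λ i _ → cong h (shift i)) ⟩
    sumBelow (suc m) (λ i → g (suc i % suc m))       ≡⟨ cong₂ _+_ (cong g (n%n≡0 (suc m)))
                                                          (sumBelow-cong m (λ i i<m → cong g (m<n⇒m%n≡m (s≤s i<m)))) ⟩
    g 0 + sumBelow m (λ i → g (suc i))                ≡⟨ sumBelow-suc m g ⟨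
    sumBelow (suc m) g                                ≡⟨ sumBelow-rotate (suc m) x h ⟩
    sumBelow (suc m) h                                ∎
    where
    g : ℕ → ℕ
    g j = h ((x + j) % suc m)
    shift : ∀ i → (suc x + i) % suc m ≡ (x + suc i % suc m) % suc m
    shift i = begin
      (suc x + i) % suc m                   ≡⟨ cong (_% suc m) (+-suc x i) ⟨
      (x + suc i) % suc m                   ≡⟨ %-distribˡ-+ x (suc i) (suc m) ⟩
      (x % suc m + suc i % suc m) % suc m   ≡⟨ cong (λ z → (x % suc m + z) % suc m) (m%n%n≡m%n (suc i) (suc m)) ⟨
      (x % suc m + suc i % suc m % suc m) % suc m ≡⟨ %-distribˡ-+ x (suc i % suc m) (suc m) ⟨
      (x + suc i % suc m) % suc m           ∎

  n≤sumBelow : ∀ n {g} → (∀ i → i < n → 1 ≤ g i) → n ≤ sumBelow n g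
  n≤sumBelow n 1≤g =
    ≤-trans (≤-reflexive (sym (trans (sumBelow-const n 1) (*-identityʳ n)))) (sumBelow-mono-≤ n 1≤g)

  sumBelow≡n⇒all≡1 : ∀ n g → sumBelow n g ≡ n → (∀ i → i < n → 1 ≤ g i) → ∀ i → i < n → g i ≡ 1
  sumBelow≡n⇒all≡1 (suc n) g sum≡ 1≤g i i<1+n with i ≟ n
  ... | yes refl = ≤-antisym top≤1 (1≤g n ≤-refl)
    where
    top≤1 : g n ≤ 1
    top≤1 = +-cancelʳ-≤ n (g n) 1 (≤-trans (+-monoʳ-≤ (g n) (n≤sumBelow n (λ j j<n → 1≤g j (m<n⇒m<1+n j<n))))
                                    (≤-reflexive sum≡))
  ... | no i≢n = sumBelow≡n⇒all≡1 n g rest≡n (λ j j<n → 1≤g j (m<n⇒m<1+n j<n)) i (≤∧≢⇒< (≤-pred i<1+n) i≢n)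
    where
    rest≡n : sumBelow n g ≡ n
    rest≡n = ≤-antisym (+-cancelˡ-≤ 1 (sumBelow n g) n (≤-trans (+-monoˡ-≤ _ (1≤g n ≤-refl)) (≤-reflexive sum≡)))
                     (n≤sumBelow n (λ j j<n → 1≤g j (m<n⇒m<1+n j<n)))

module Counting where
  open import Data.Bool using (Bool; true; false; _∧_; not; T)
  open import Data.Bool.Properties using (T-∨)
  open import Function.Bundles using (Equivalence)
  open import Data.Nat
  open import Data.Nat.Properties
  open import Data.Fin using (Fin)
  import Data.Fin.Properties as Fin
  open import Data.Product using (∃; _×_; _,_)
  open import Data.Sum using (inj₁; inj₂)
  open import Data.Empty using (⊥-elim)
  open import Relation.Nullary using (¬_; yes; no)
  open import Relation.Nullary.Decidable using (⌊_⌋)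
  open import Relation.Unary using (Decidable)
  open import Relation.Binary.PropositionalEquality
  open import Defs using (count; finSum; anyFin)
  open FiniteSums

  count≡sumBelow : ∀ n f → count n f ≡ sumBelow n (λ i → 𝟙 (f i))
  count≡sumBelow zero    f = refl
  count≡sumBelow (suc n) f with f n
  ... | true  = cong suc (count≡sumBelow n f)
  ... | false = count≡sumBelow n f

  count-cong : ∀ n {f g : ℕ → Bool} → (∀ i → i < n → f i ≡ g i) → count n f ≡ count n g
  count-cong zero    f≗g = refl
  count-cong (suc n) f≗g rewrite f≗g n ≤-refl =
    cong (_ +_) (count-cong n (λ i i<n → f≗g i (m<n⇒m<1+n i<n)))

  count-remove : ∀ n (Q : ℕ → Bool) {v} → v < n → Q v ≡ true →
    count n Q ≡ suc (count n (λ j → Q j ∧ not ⌊ j ≟ v ⌋))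
  count-remove (suc n) Q {v} v<1+n Qv with n ≟ v
  ... | yes refl rewrite Qv = cong suc (count-cong n (λ j j<n → sym (Q∧true (Q j) (⌊≟⌋-≢ (<⇒≢ j<n)))))
    where
    Q∧true : ∀ b {c} → c ≡ false → (b ∧ not c) ≡ b
    Q∧true true  refl = refl
    Q∧true false refl = refl
  ... | no n≢v with Q n
  ...   | true  = cong suc (count-remove n Q (≤∧≢⇒< (≤-pred v<1+n) (≢-sym n≢v)) Qv)
  ...   | false = count-remove n Q (≤∧≢⇒< (≤-pred v<1+n) (≢-sym n≢v)) Qv

  count-injection : ∀ a b (P Q : ℕ → Bool) (σ : ∀ i → P i ≡ true → ℕ) →
    (∀ i → i < a → (Pi : P i ≡ true) → σ i Pi < b × Q (σ i Pi) ≡ true) →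
    (∀ i j → i < a → j < a → (Pi : P i ≡ true) (Pj : P j ≡ true) → σ i Pi ≡ σ j Pj → i ≡ j) →
    count a P ≤ count b Q
  count-injection zero    b P Q σ maps inj = z≤n
  count-injection (suc a) b P Q σ maps inj with P a in Pa
  ... | false = count-injection a b P Q σ (λ i i<a → maps i (m<n⇒m<1+n i<a))
                  (λ i j i<a j<a → inj i j (m<n⇒m<1+n i<a) (m<n⇒m<1+n j<a))
  ... | true  with maps a ≤-refl Pa
  ...   | σa<b , Qσa = ≤-trans (s≤s rest) (≤-reflexive (sym (count-remove b Q σa<b Qσa)))
    where
    rest : count a P ≤ count b (λ j → Q j ∧ not ⌊ j ≟ σ a Pa ⌋)
    rest = count-injection a b P _ σ maps′ (λ i j i<a j<a → inj i j (m<n⇒m<1+n i<a) (m<n⇒m<1+n j<a))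
      where
      maps′ : ∀ i → i < a → (Pi : P i ≡ true) → σ i Pi < b × (Q (σ i Pi) ∧ not ⌊ σ i Pi ≟ σ a Pa ⌋) ≡ true
      maps′ i i<a Pi with maps i (m<n⇒m<1+n i<a) Pi
      ... | σi<b , Qσi rewrite Qσi
          | ⌊≟⌋-≢ (λ σi≡σa → <⇒≢ i<a (inj i a (m<n⇒m<1+n i<a) ≤-refl Pi Pa σi≡σa)) = σi<b , refl

  count-true : ∀ n → count n (λ _ → true) ≡ n
  count-true zero    = refl
  count-true (suc n) = cong suc (count-true n)

  count-≢ : ∀ n {v} → v < n → count n (λ j → not ⌊ j ≟ v ⌋) ≡ n ∸ 1
  count-≢ n v<n = cong (_∸ 1) (trans (sym (count-remove n (λ _ → true) v<n refl)) (count-true n))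

  count-* : ∀ k n {f : ℕ → Bool} → (∀ i → f (n + i) ≡ f i) → count (k * n) f ≡ k * count n f
  count-* k n {f} f-periodic = trans (count≡sumBelow (k * n) f) (trans
    (sumBelow-periodic k n (λ i → cong 𝟙 (f-periodic i))) (cong (k *_) (sym (count≡sumBelow n f))))

  least : ∀ {p} {P : ℕ → Set p} → Decidable P → ∀ {e} → P e → ∃ λ o → P o × (∀ k → k < o → ¬ P k)
  least {P = P} P? {e} Pe = search e 0 (λ _ ()) Pe
    where
    search : ∀ fuel k → (∀ j → j < k → ¬ P j) → P (k + fuel) → ∃ λ o → P o × (∀ j → j < o → ¬ P j)
    search fuel k below P[k+fuel] with P? k
    search fuel       k below P[k+fuel] | yes Pk = k , Pk , below
    search zero       k below P[k+fuel] | no ¬Pk = ⊥-elim (¬Pk (subst P (+-identityʳ k) P[k+fuel]))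
    search (suc fuel) k below P[k+fuel] | no ¬Pk = search fuel (suc k) below′ (subst P (+-suc k fuel) P[k+fuel])
      where
      below′ : ∀ j → j < suc k → ¬ P j
      below′ j j<1+k with j ≟ k
      ... | yes refl = ¬Pk
      ... | no j≢k   = below j (≤∧≢⇒< (≤-pred j<1+k) j≢k)

  finSum-cong : ∀ s {f g : Fin s → ℕ} → (∀ j → f j ≡ g j) → finSum f ≡ finSum g
  finSum-cong zero    f≗g = refl
  finSum-cong (suc s) f≗g = cong₂ _+_ (f≗g Fin.zero) (finSum-cong s (λ j → f≗g (Fin.suc j)))

  finSum-const : ∀ s c → finSum {s} (λ _ → c) ≡ s * c
  finSum-const zero    c = refl
  finSum-const (suc s) c = cong (c +_) (finSum-const s c)

  finSum-*ˡ : ∀ s c (f : Fin s → ℕ) → finSum (λ j → c * f j) ≡ c * finSum f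
  finSum-*ˡ zero    c f = sym (*-zeroʳ c)
  finSum-*ˡ (suc s) c f =
    trans (cong (c * f Fin.zero +_) (finSum-*ˡ s c (λ j → f (Fin.suc j)))) (sym (*-distribˡ-+ c _ _))

  finSum-sumBelow : ∀ s n (f : Fin s → ℕ → ℕ) →
    finSum (λ j → sumBelow n (f j)) ≡ sumBelow n (λ u → finSum (λ j → f j u))
  finSum-sumBelow zero    n f = sym (sumBelow-0 n (λ _ _ → refl))
  finSum-sumBelow (suc s) n f =
    trans (cong (sumBelow n (f Fin.zero) +_) (finSum-sumBelow s n (λ j → f (Fin.suc j))))
          (sym (sumBelow-distrib-+ n (f Fin.zero) (λ u → finSum (λ j → f (Fin.suc j) u))))

  finSum-select : ∀ s (f : Fin s → ℕ) j₀ → f j₀ ≡ 1 → (∀ j → j ≢ j₀ → f j ≡ 0) → finSum f ≡ 1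
  finSum-select (suc s) f Fin.zero    f₀≡1 others rewrite f₀≡1 =
    cong suc (trans (finSum-cong s (λ j → others (Fin.suc j) (λ ()))) (trans (finSum-const s 0) (*-zeroʳ s)))
  finSum-select (suc s) f (Fin.suc j₀) fj₀≡1 others rewrite others Fin.zero (λ ()) =
    finSum-select s (λ j → f (Fin.suc j)) j₀ fj₀≡1 (λ j j≢j₀ → others (Fin.suc j) (λ eq → j≢j₀ (Fin.suc-injective eq)))

  T-injective : ∀ {x y} → (T x → T y) → (T y → T x) → x ≡ y
  T-injective {true}  {true}  _ _ = refl
  T-injective {true}  {false} x⇒y _ = ⊥-elim (x⇒y _)
  T-injective {false} {true}  _ y⇒x = ⊥-elim (y⇒x _)
  T-injective {false} {false} _ _ = refl

  anyFin⁻ : ∀ {n} (f : Fin n → Bool) → T (anyFin f) → ∃ λ i → T (f i)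
  anyFin⁻ {suc n} f any-f with Equivalence.to T-∨ any-f
  ... | inj₁ f₀     = Fin.zero , f₀
  ... | inj₂ any-f′ with anyFin⁻ (λ i → f (Fin.suc i)) any-f′
  ...   | i , fi = Fin.suc i , fi

  anyFin⁺ : ∀ {n} (f : Fin n → Bool) i → T (f i) → T (anyFin f)
  anyFin⁺ {suc n} f Fin.zero    f₀ = Equivalence.from T-∨ (inj₁ f₀)
  anyFin⁺ {suc n} f (Fin.suc i) fi = Equivalence.from T-∨ (inj₂ (anyFin⁺ (λ j → f (Fin.suc j)) i fi))

module ModularArithmetic where
  open import Data.Nat
  open import Data.Nat.Properties
  open import Data.Nat.DivMod
  open import Data.Nat.Divisibility using (_∣_; divides)
  open import Data.Sum using (inj₁; inj₂)
  open import Relation.Binary.PropositionalEquality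

  module _ (n : ℕ) .{{_ : NonZero n}} where

    %-*-%ˡ : ∀ a b → (a % n * b) % n ≡ (a * b) % n
    %-*-%ˡ a b = begin
      (a % n * b) % n               ≡⟨ %-distribˡ-* (a % n) b n ⟩
      (a % n % n * (b % n)) % n     ≡⟨ cong (λ z → (z * (b % n)) % n) (m%n%n≡m%n a n) ⟩
      (a % n * (b % n)) % n         ≡⟨ %-distribˡ-* a b n ⟨
      (a * b) % n                   ∎
      where open ≡-Reasoning

    %-*-≡1 : ∀ b {a} → a % n ≡ 1 → (b * a) % n ≡ b % n
    %-*-≡1 b {a} a≡1 = begin
      (b * a) % n                   ≡⟨ %-distribˡ-* b a n ⟩
      (b % n * (a % n)) % n         ≡⟨ cong (λ z → (b % n * z) % n) a≡1 ⟩
      (b % n * 1) % n               ≡⟨ cong (_% n) (*-identityʳ (b % n)) ⟩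
      b % n % n                     ≡⟨ m%n%n≡m%n b n ⟩
      b % n                         ∎
      where open ≡-Reasoning

    %-+-≡⇒∣ : ∀ x δ → (x + δ) % n ≡ x % n → n ∣ δ
    %-+-≡⇒∣ x δ eq = divides ((x % n + δ) / n) (+-cancelˡ-≡ (x % n) δ _ (trans (m≡m%n+[m/n]*n (x % n + δ) n)
      (cong (_+ (x % n + δ) / n * n) reduced)))
      where
      reduced : (x % n + δ) % n ≡ x % n
      reduced = begin
        (x % n + δ) % n             ≡⟨ %-distribˡ-+ (x % n) δ n ⟩
        (x % n % n + δ % n) % n     ≡⟨ cong (λ z → (z + δ % n) % n) (m%n%n≡m%n x n) ⟩
        (x % n + δ % n) % n         ≡⟨ %-distribˡ-+ x δ n ⟨
        (x + δ) % n                 ≡⟨ eq ⟩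
        x % n                       ∎
        where open ≡-Reasoning

    %-cancelˡ-*-≤ : ∀ a {x y} → (∀ z → n ∣ a * z → n ∣ z) → y ≤ x → (a * x) % n ≡ (a * y) % n → x % n ≡ y % n
    %-cancelˡ-*-≤ a {x} {y} cancellable y≤x eq =
      trans (cong (_% n) (sym x≡y+d)) (%-remove-+ʳ y (cancellable (x ∸ y) (%-+-≡⇒∣ (a * y) (a * (x ∸ y)) eq′)))
      where
      x≡y+d = m+[n∸m]≡n y≤x
      eq′ : (a * y + a * (x ∸ y)) % n ≡ (a * y) % n
      eq′ = trans (cong (_% n) (trans (sym (*-distribˡ-+ a y (x ∸ y))) (cong (a *_) x≡y+d))) eq

    %-cancelˡ-* : ∀ a {x y} → (∀ z → n ∣ a * z → n ∣ z) → (a * x) % n ≡ (a * y) % n → x % n ≡ y % n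
    %-cancelˡ-* a {x} {y} cancellable eq with ≤-total y x
    ... | inj₁ y≤x = %-cancelˡ-*-≤ a cancellable y≤x eq
    ... | inj₂ x≤y = sym (%-cancelˡ-*-≤ a cancellable x≤y (sym eq))

module DifferenceSets where
  open import Data.Bool using (Bool; true; _∧_)
  open import Data.Nat
  open import Data.Nat.Properties
  open import Data.Nat.DivMod
  open import Data.Nat.Divisibility using (_∣_; divides; n∣m⇒m%n≡0; m%n≡0⇒n∣m)
  open import Data.Nat.Solver using (module +-*-Solver)
  open import Data.Product using (∃; _×_; _,_)
  open import Data.Empty using (⊥-elim)
  open import Relation.Nullary using (yes; no)
  open import Relation.Nullary.Decidable using (⌊_⌋)
  open import Relation.Binary.PropositionalEquality
  open import Defs using (count)
  open import Algebra.Properties.CommutativeSemigroup *-commutativeSemigroup using (x∙yz≈y∙xz)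
  open FiniteSums
  open Counting
  open ModularArithmetic using (%-+-≡⇒∣)
  open +-*-Solver using (solve; _:+_; _:*_; _:=_; con)

  module PerfectDifferenceSet (q : ℕ) (D : ℕ → Bool) where

    n : ℕ
    n = suc (q * q + q)

    𝟙D : ℕ → ℕ
    𝟙D x = 𝟙 (D x)

    size : ℕ
    size = sumBelow n 𝟙D

    representations : ℕ → ℕ
    representations δ = sumBelow n (λ x → 𝟙D x * 𝟙D ((x + δ) % n))

    sumBelow-representations : sumBelow n representations ≡ size * size
    sumBelow-representations = begin
      sumBelow n representations
        ≡⟨ sumBelow-comm n n (λ δ x → 𝟙D x * 𝟙D ((x + δ) % n)) ⟩
      sumBelow n (λ x → sumBelow n (λ δ → 𝟙D x * 𝟙D ((x + δ) % n)))
        ≡⟨ sumBelow-cong n (λ x _ → sumBelow-*ˡ n (𝟙D x) (λ δ → 𝟙D ((x + δ) % n))) ⟩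
      sumBelow n (λ x → 𝟙D x * sumBelow n (λ δ → 𝟙D ((x + δ) % n)))
        ≡⟨ sumBelow-cong n (λ x _ → cong (𝟙D x *_) (sumBelow-rotate n x 𝟙D)) ⟩
      sumBelow n (λ x → 𝟙D x * size)
        ≡⟨ sumBelow-*ʳ n size 𝟙D ⟩
      size * size ∎
      where open ≡-Reasoning

    representations-0 : representations 0 ≡ size
    representations-0 = sumBelow-cong n (λ x x<n →
      trans (cong (λ z → 𝟙D x * 𝟙D z) (trans (cong (_% n) (+-identityʳ x)) (m<n⇒m%n≡m x<n))) (𝟙-idem (D x)))

    module _ (1≤q : 1 ≤ q)
      (every-difference : ∀ δ → 0 < δ → δ < n →
        ∃ λ x → x < n × D x ≡ true × D ((x + δ) % n) ≡ true)
      (count≤q+1 : count n D ≤ q + 1) where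

      1≤representations : ∀ δ → 0 < δ → δ < n → 1 ≤ representations δ
      1≤representations δ 0<δ δ<n with every-difference δ 0<δ δ<n
      ... | x , x<n , Dx , Dx+δ = ≤-trans (≤-reflexive (sym (cong₂ (λ a b → 𝟙 a * 𝟙 b) Dx Dx+δ)))
                                           (term≤sumBelow n (λ x → 𝟙D x * 𝟙D ((x + δ) % n)) x<n)

      nonzero-representations : ℕ
      nonzero-representations = sumBelow (q * q + q) (λ i → representations (suc i))

      size²≡size+nonzero : size * size ≡ size + nonzero-representations
      size²≡size+nonzero = trans (sym sumBelow-representations)
        (trans (sumBelow-suc (q * q + q) representations) (cong (_+ nonzero-representations) representations-0))

      q*q+q≤nonzero : q * q + q ≤ nonzero-representations
      q*q+q≤nonzero = n≤sumBelow (q * q + q) (λ i i<m → 1≤representations (suc i) (s≤s z≤n) (s≤s i<m))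

      size≡q+1 : size ≡ q + 1
      size≡q+1 with size ≤? q
      ... | no size≰q = ≤-antisym size≤q+1 (≤-trans (≤-reflexive (+-comm q 1)) (≰⇒> size≰q))
        where size≤q+1 = ≤-trans (≤-reflexive (sym (count≡sumBelow n D))) count≤q+1
      ... | yes size≤q = ⊥-elim (<-irrefl refl (begin-strict
        size * size                        ≤⟨ *-mono-≤ size≤q size≤q ⟩
        q * q                              <⟨ m<m+n (q * q) 1≤q ⟩
        q * q + q                          ≤⟨ q*q+q≤nonzero ⟩
        nonzero-representations            ≤⟨ m≤n+m _ size ⟩
        size + nonzero-representations     ≡⟨ size²≡size+nonzero ⟨
        size * size                        ∎))
        where open ≤-Reasoning

      nonzero≡q*q+q : nonzero-representations ≡ q * q + q
      nonzero≡q*q+q = +-cancelˡ-≡ (q + 1) _ _ (begin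
        q + 1 + nonzero-representations     ≡⟨ cong (_+ nonzero-representations) size≡q+1 ⟨
        size + nonzero-representations      ≡⟨ size²≡size+nonzero ⟨
        size * size                         ≡⟨ cong (λ z → z * z) size≡q+1 ⟩
        (q + 1) * (q + 1)                   ≡⟨ solve 1 (λ q → (q :+ con 1) :* (q :+ con 1) := (q :+ con 1) :+ (q :* q :+ q)) refl q ⟩
        q + 1 + (q * q + q)                 ∎)
        where open ≡-Reasoning

      representations≡1 : ∀ δ → 0 < δ → δ < n → representations δ ≡ 1
      representations≡1 (suc i) _ (s≤s i<m) = sumBelow≡n⇒all≡1 (q * q + q) (λ i → representations (suc i)) nonzero≡q*q+q
        (λ j j<m → 1≤representations (suc j) (s≤s z≤n) (s≤s j<m)) i i<m

      module Residues (t₁ d : ℕ) (t*d≡n : suc t₁ * d ≡ n) where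

        t : ℕ
        t = suc t₁

        classWeight : ℕ → ℕ
        classWeight u = count n (λ i → D i ∧ ⌊ i % t ≟ u ⌋)

        inClass : ℕ → ℕ → ℕ
        inClass u i = 𝟙 ⌊ i % t ≟ u ⌋ * 𝟙D i

        classWeight≡sumBelow : ∀ u → classWeight u ≡ sumBelow n (inClass u)
        classWeight≡sumBelow u = trans (count≡sumBelow n _) (sumBelow-cong n (λ i _ → trans (𝟙-∧ (D i) _) (*-comm (𝟙D i) _)))

        sumBelow-inClass : ∀ i → sumBelow t (λ u → inClass u i) ≡ 𝟙D i
        sumBelow-inClass i = trans (sumBelow-cong t (λ u _ → cong (λ b → 𝟙 b * 𝟙D i) (⌊≟⌋-sym (i % t) u)))
                                   (sumBelow-select t (λ _ → 𝟙D i) (m%n<n i t))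

        sumBelow-classWeight : sumBelow t classWeight ≡ q + 1
        sumBelow-classWeight = begin
          sumBelow t classWeight                              ≡⟨ sumBelow-cong t (λ u _ → classWeight≡sumBelow u) ⟩
          sumBelow t (λ u → sumBelow n (inClass u))      ≡⟨ sumBelow-comm t n inClass ⟩
          sumBelow n (λ i → sumBelow t (λ u → inClass u i)) ≡⟨ sumBelow-cong n (λ i _ → sumBelow-inClass i) ⟩
          size                                           ≡⟨ size≡q+1 ⟩
          q + 1                                          ∎
          where open ≡-Reasoning

        sumBelow-inClass² : ∀ x y → sumBelow t (λ u → inClass u x * inClass u y) ≡ 𝟙D x * (𝟙 ⌊ y % t ≟ x % t ⌋ * 𝟙D y)
        sumBelow-inClass² x y = begin
          sumBelow t (λ u → inClass u x * inClass u y)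
            ≡⟨ sumBelow-cong t (λ u _ → trans (*-assoc (𝟙 ⌊ x % t ≟ u ⌋) (𝟙D x) (𝟙 ⌊ y % t ≟ u ⌋ * 𝟙D y))
                                    (cong (λ b → 𝟙 b * (𝟙D x * (𝟙 ⌊ y % t ≟ u ⌋ * 𝟙D y))) (⌊≟⌋-sym (x % t) u))) ⟩
          sumBelow t (λ u → 𝟙 ⌊ u ≟ x % t ⌋ * (𝟙D x * (𝟙 ⌊ y % t ≟ u ⌋ * 𝟙D y)))
            ≡⟨ sumBelow-select t (λ u → 𝟙D x * (𝟙 ⌊ y % t ≟ u ⌋ * 𝟙D y)) (m%n<n x t) ⟩
          𝟙D x * (𝟙 ⌊ y % t ≟ x % t ⌋ * 𝟙D y) ∎
          where open ≡-Reasoning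

        t∣n : t ∣ n
        t∣n = divides d (trans (sym t*d≡n) (*-comm t d))

        sameClass≡difference : ∀ x δ → ⌊ (x + δ) % n % t ≟ x % t ⌋ ≡ ⌊ δ % t ≟ 0 ⌋
        sameClass≡difference x δ = trans (cong (λ z → ⌊ z ≟ x % t ⌋) (m∣n⇒o%n%m≡o%m t n (x + δ) t∣n)) decide
          where
          decide : ⌊ (x + δ) % t ≟ x % t ⌋ ≡ ⌊ δ % t ≟ 0 ⌋
          decide with (x + δ) % t ≟ x % t | δ % t ≟ 0
          ... | yes _  | yes _  = refl
          ... | no _   | no _   = refl
          ... | yes eq | no ≢0  = ⊥-elim (≢0 (n∣m⇒m%n≡0 δ t (%-+-≡⇒∣ t x δ eq)))
          ... | no ≢   | yes ≡0 = ⊥-elim (≢ (%-remove-+ʳ x (m%n≡0⇒n∣m δ t ≡0)))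

        multiples : ∀ k → sumBelow (t * k) (λ δ → 𝟙 ⌊ δ % t ≟ 0 ⌋) ≡ k
        multiples zero    = cong (λ z → sumBelow z (λ δ → 𝟙 ⌊ δ % t ≟ 0 ⌋)) (*-zeroʳ t)
        multiples (suc k) = begin
          sumBelow (t * suc k) divisible                    ≡⟨ cong (λ z → sumBelow z divisible) (*-suc t k) ⟩
          sumBelow (t + t * k) divisible                    ≡⟨ sumBelow-+ t (t * k) divisible ⟩
          sumBelow (t * k) divisible + sumBelow t (λ i → divisible (t * k + i))
                                                            ≡⟨ cong₂ _+_ (multiples k) (sumBelow-cong t last-block) ⟩
          k + sumBelow t (λ i → 𝟙 ⌊ i ≟ 0 ⌋ * 1)           ≡⟨ cong (k +_) (sumBelow-select t (λ _ → 1) (s≤s z≤n)) ⟩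
          k + 1                                             ≡⟨ +-comm k 1 ⟩
          suc k                                             ∎
          where
          open ≡-Reasoning
          divisible : ℕ → ℕ
          divisible δ = 𝟙 ⌊ δ % t ≟ 0 ⌋
          last-block : ∀ i → i < t → divisible (t * k + i) ≡ 𝟙 ⌊ i ≟ 0 ⌋ * 1
          last-block i i<t = trans (cong (λ z → 𝟙 ⌊ z ≟ 0 ⌋) (trans (cong (_% t) (trans (+-comm (t * k) i) (cong (i +_) (*-comm t k))))
                                    (trans ([m+kn]%n≡m%n i k t) (m<n⇒m%n≡m i<t))))
                                   (sym (*-identityʳ _))

        sumBelow-classWeight²≡pairs : sumBelow t (λ u → classWeight u * classWeight u) ≡
          sumBelow n (λ x → sumBelow n (λ y → 𝟙D x * (𝟙 ⌊ y % t ≟ x % t ⌋ * 𝟙D y)))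
        sumBelow-classWeight²≡pairs = begin
          sumBelow t (λ u → classWeight u * classWeight u)
            ≡⟨ sumBelow-cong t (λ u _ → trans (cong₂ _*_ (classWeight≡sumBelow u) (classWeight≡sumBelow u))
                                               (sumBelow-square n (inClass u) (inClass u))) ⟩
          sumBelow t (λ u → sumBelow n (λ x → sumBelow n (λ y → inClass u x * inClass u y)))
            ≡⟨ sumBelow-comm t n _ ⟩
          sumBelow n (λ x → sumBelow t (λ u → sumBelow n (λ y → inClass u x * inClass u y)))
            ≡⟨ sumBelow-cong n (λ x _ → trans (sumBelow-comm t n _) (sumBelow-cong n (λ y _ → sumBelow-inClass² x y))) ⟩
          sumBelow n (λ x → sumBelow n (λ y → 𝟙D x * (𝟙 ⌊ y % t ≟ x % t ⌋ * 𝟙D y))) ∎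
          where open ≡-Reasoning

        sameClass-rotate : ∀ x → sumBelow n (λ y → 𝟙 ⌊ y % t ≟ x % t ⌋ * 𝟙D y) ≡
                                  sumBelow n (λ δ → 𝟙 ⌊ δ % t ≟ 0 ⌋ * 𝟙D ((x + δ) % n))
        sameClass-rotate x = begin
          sumBelow n (λ y → 𝟙 ⌊ y % t ≟ x % t ⌋ * 𝟙D y)
            ≡⟨ sumBelow-rotate n x (λ y → 𝟙 ⌊ y % t ≟ x % t ⌋ * 𝟙D y) ⟨
          sumBelow n (λ δ → 𝟙 ⌊ (x + δ) % n % t ≟ x % t ⌋ * 𝟙D ((x + δ) % n))
            ≡⟨ sumBelow-cong n (λ δ _ → cong (λ b → 𝟙 b * 𝟙D ((x + δ) % n)) (sameClass≡difference x δ)) ⟩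
          sumBelow n (λ δ → 𝟙 ⌊ δ % t ≟ 0 ⌋ * 𝟙D ((x + δ) % n)) ∎
          where open ≡-Reasoning

        pairs≡representations : sumBelow n (λ x → sumBelow n (λ y → 𝟙D x * (𝟙 ⌊ y % t ≟ x % t ⌋ * 𝟙D y))) ≡
                                sumBelow n (λ δ → 𝟙 ⌊ δ % t ≟ 0 ⌋ * representations δ)
        pairs≡representations = begin
          sumBelow n (λ x → sumBelow n (λ y → 𝟙D x * (𝟙 ⌊ y % t ≟ x % t ⌋ * 𝟙D y)))
            ≡⟨ sumBelow-cong n (λ x _ → trans (sumBelow-*ˡ n (𝟙D x) _) (cong (𝟙D x *_) (sameClass-rotate x))) ⟩
          sumBelow n (λ x → 𝟙D x * sumBelow n (λ δ → 𝟙 ⌊ δ % t ≟ 0 ⌋ * 𝟙D ((x + δ) % n)))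
            ≡⟨ sumBelow-cong n (λ x _ → sym (sumBelow-*ˡ n (𝟙D x) _)) ⟩
          sumBelow n (λ x → sumBelow n (λ δ → 𝟙D x * (𝟙 ⌊ δ % t ≟ 0 ⌋ * 𝟙D ((x + δ) % n))))
            ≡⟨ sumBelow-comm n n _ ⟩
          sumBelow n (λ δ → sumBelow n (λ x → 𝟙D x * (𝟙 ⌊ δ % t ≟ 0 ⌋ * 𝟙D ((x + δ) % n))))
            ≡⟨ sumBelow-cong n (λ δ _ → trans (sumBelow-cong n (λ x _ → x∙yz≈y∙xz (𝟙D x) (𝟙 ⌊ δ % t ≟ 0 ⌋) _))
                                              (sumBelow-*ˡ n (𝟙 ⌊ δ % t ≟ 0 ⌋) _)) ⟩
          sumBelow n (λ δ → 𝟙 ⌊ δ % t ≟ 0 ⌋ * representations δ) ∎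
          where open ≡-Reasoning

        sumBelow-classWeight² : sumBelow t (λ u → classWeight u * classWeight u) ≡ q + d
        sumBelow-classWeight² = begin
          sumBelow t (λ u → classWeight u * classWeight u)
            ≡⟨ trans sumBelow-classWeight²≡pairs pairs≡representations ⟩
          sumBelow n (λ δ → 𝟙 ⌊ δ % t ≟ 0 ⌋ * representations δ)
            ≡⟨ sumBelow-suc (q * q + q) _ ⟩
          1 * representations 0 + sumBelow (q * q + q) (λ i → 𝟙 ⌊ suc i % t ≟ 0 ⌋ * representations (suc i))
            ≡⟨ cong₂ _+_ (trans (*-identityˡ _) (trans representations-0 size≡q+1))
                         (sumBelow-cong (q * q + q) (λ i i<m →
                            trans (cong (𝟙 ⌊ suc i % t ≟ 0 ⌋ *_) (representations≡1 (suc i) (s≤s z≤n) (s≤s i<m)))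
                                  (*-identityʳ _))) ⟩
          q + 1 + sumBelow (q * q + q) (λ i → 𝟙 ⌊ suc i % t ≟ 0 ⌋)
            ≡⟨ trans (+-assoc q 1 _) (cong (q +_) (sym (sumBelow-suc (q * q + q) (λ δ → 𝟙 ⌊ δ % t ≟ 0 ⌋)))) ⟩
          q + sumBelow n (λ δ → 𝟙 ⌊ δ % t ≟ 0 ⌋)
            ≡⟨ cong (λ z → q + sumBelow z (λ δ → 𝟙 ⌊ δ % t ≟ 0 ⌋)) t*d≡n ⟨
          q + sumBelow (t * d) (λ δ → 𝟙 ⌊ δ % t ≟ 0 ⌋)
            ≡⟨ cong (q +_) (multiples d) ⟩
          q + d ∎
          where open ≡-Reasoning

module MultiplicativeOrbits where
  open import Data.Nat
  open import Data.Nat.Properties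
  open import Data.Nat.DivMod
  open import Data.Nat.Divisibility using (_∣_; m%n≡0⇒n∣m; ∣⇒≤; ∣1⇒≡1)
  open import Data.Nat.Primality using (Prime; euclidsLemma; prime⇒nonTrivial)
  open import Data.Fin using (Fin; toℕ; fromℕ<)
  import Data.Fin.Properties as Fin
  open import Data.Product using (∃; _×_; _,_; proj₁; proj₂)
  open import Data.Sum using (inj₁; inj₂)
  open import Data.Empty using (⊥-elim)
  open import Relation.Nullary using (¬_)
  open import Relation.Nullary.Decidable using (⌊_⌋)
  open import Relation.Binary.PropositionalEquality
  open import Relation.Binary.Definitions using (tri<; tri≈; tri>)
  open import Defs using (finSum; SameOrbit)
  open FiniteSums
  open Counting
  open ModularArithmetic

  module PowerOrbits (p t₁ : ℕ) (t-prime : Prime (suc t₁)) (t∤p : ¬ suc t₁ ∣ p) where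

    t : ℕ
    t = suc t₁

    1<t : 1 < t
    1<t = nonTrivial⇒n>1 t {{prime⇒nonTrivial t-prime}}

    1%t≡1 : 1 % t ≡ 1
    1%t≡1 = m<n⇒m%n≡m 1<t

    cancellable : ∀ {a} → ¬ t ∣ a → ∀ z → t ∣ a * z → t ∣ z
    cancellable {a} t∤a z t∣az with euclidsLemma a z t-prime t∣az
    ... | inj₁ t∣a = ⊥-elim (t∤a t∣a)
    ... | inj₂ t∣z = t∣z

    t∤* : ∀ {a b} → ¬ t ∣ a → ¬ t ∣ b → ¬ t ∣ a * b
    t∤* t∤a t∤b t∣ab = t∤b (cancellable t∤a _ t∣ab)

    t∤p^ : ∀ k → ¬ t ∣ p ^ k
    t∤p^ zero    t∣1 = <-irrefl (sym (∣1⇒≡1 t∣1)) 1<t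
    t∤p^ (suc k) = t∤* t∤p (t∤p^ k)

    t∤nonzero : ∀ {r} → 1 ≤ r → r < t → ¬ t ∣ r
    t∤nonzero {suc r} _ r<t t∣r = <-irrefl refl (≤-trans r<t (∣⇒≤ t∣r))

    p^-collision : ∃ λ i → ∃ λ j → i < j × p ^ i % t ≡ p ^ j % t
    p^-collision with Fin.pigeonhole (n<1+n t) (λ i → fromℕ< (m%n<n (p ^ toℕ i) t))
    ... | i , j , i<j , fi≡fj =
      toℕ i , toℕ j , i<j , trans (sym (Fin.toℕ-fromℕ< _)) (trans (cong toℕ fi≡fj) (Fin.toℕ-fromℕ< _))

    p^∸≡1 : ∀ {i j} → i ≤ j → p ^ i % t ≡ p ^ j % t → p ^ (j ∸ i) % t ≡ 1
    p^∸≡1 {i} {j} i≤j eq = sym (trans (sym 1%t≡1) (%-cancelˡ-* t (p ^ i) (cancellable (t∤p^ i)) (begin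
      (p ^ i * 1) % t          ≡⟨ cong (_% t) (*-identityʳ (p ^ i)) ⟩
      p ^ i % t                ≡⟨ eq ⟩
      p ^ j % t                ≡⟨ cong (λ k → p ^ k % t) (m+[n∸m]≡n i≤j) ⟨
      p ^ (i + (j ∸ i)) % t    ≡⟨ cong (_% t) (^-distribˡ-+-* p i (j ∸ i)) ⟩
      (p ^ i * p ^ (j ∸ i)) % t ∎)))
      where open ≡-Reasoning

    -- Kept opaque: the exponent comes from a pigeonhole search that must not be normalised.
    opaque
      p^suc≡1 : ∃ λ e → p ^ suc e % t ≡ 1
      p^suc≡1 with p^-collision
      ... | i , j , i<j , eq = pred (j ∸ i) , subst (λ k → p ^ k % t ≡ 1) (sym (suc-pred (j ∸ i))) (p^∸≡1 (<⇒≤ i<j) eq)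
        where
        instance
          j∸i≢0 : NonZero (j ∸ i)
          j∸i≢0 = >-nonZero (m<n⇒0<n∸m i<j)

      minimal-exponent : ∃ λ e → p ^ suc e % t ≡ 1 × (∀ k → k < e → p ^ suc k % t ≢ 1)
      minimal-exponent = least {P = λ e → p ^ suc e % t ≡ 1} (λ e → p ^ suc e % t ≟ 1) {proj₁ p^suc≡1} (proj₂ p^suc≡1)

    order : ℕ
    order = suc (proj₁ minimal-exponent)

    p^order : p ^ order % t ≡ 1
    p^order = proj₁ (proj₂ minimal-exponent)

    order-minimal : ∀ k → 1 ≤ k → k < order → p ^ k % t ≢ 1
    order-minimal (suc k) _ k<order = proj₂ (proj₂ minimal-exponent) k (≤-pred k<order)

    p^[m*order] : ∀ m → p ^ (m * order) % t ≡ 1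
    p^[m*order] zero    = 1%t≡1
    p^[m*order] (suc m) = begin
      p ^ (order + m * order) % t       ≡⟨ cong (_% t) (^-distribˡ-+-* p order (m * order)) ⟩
      (p ^ order * p ^ (m * order)) % t ≡⟨ %-*-≡1 t (p ^ order) (p^[m*order] m) ⟩
      p ^ order % t                     ≡⟨ p^order ⟩
      1                                 ∎
      where open ≡-Reasoning

    orbit : ℕ → ℕ → ℕ
    orbit r k = (r * p ^ k) % t

    orbit-zero : ∀ {r} → r < t → orbit r 0 ≡ r
    orbit-zero {r} r<t = trans (cong (_% t) (*-identityʳ r)) (m<n⇒m%n≡m r<t)

    orbit-orbit : ∀ r k m → orbit (orbit r k) m ≡ orbit r (k + m)
    orbit-orbit r k m = begin
      ((r * p ^ k) % t * p ^ m) % t ≡⟨ %-*-%ˡ t (r * p ^ k) (p ^ m) ⟩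
      (r * p ^ k * p ^ m) % t       ≡⟨ cong (_% t) (*-assoc r (p ^ k) (p ^ m)) ⟩
      (r * (p ^ k * p ^ m)) % t     ≡⟨ cong (λ z → (r * z) % t) (^-distribˡ-+-* p k m) ⟨
      orbit r (k + m)               ∎
      where open ≡-Reasoning

    orbit-suc : ∀ r k → (orbit r k * p) % t ≡ orbit r (suc k)
    orbit-suc r k = trans (cong (λ z → (orbit r k * z) % t) (sym (*-identityʳ p)))
                          (trans (orbit-orbit r k 1) (cong (orbit r) (+-comm k 1)))

    orbit-+order : ∀ r k m → orbit r (k + m * order) ≡ orbit r k
    orbit-+order r k m = begin
      (r * p ^ (k + m * order)) % t       ≡⟨ cong (λ z → (r * z) % t) (^-distribˡ-+-* p k (m * order)) ⟩
      (r * (p ^ k * p ^ (m * order))) % t ≡⟨ cong (_% t) (*-assoc r (p ^ k) _) ⟨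
      (r * p ^ k * p ^ (m * order)) % t   ≡⟨ %-*-≡1 t (r * p ^ k) (p^[m*order] m) ⟩
      orbit r k                           ∎
      where open ≡-Reasoning

    orbit-%order : ∀ r k → orbit r k ≡ orbit r (k % order)
    orbit-%order r k = trans (cong (orbit r) (m≡m%n+[m/n]*n k order)) (orbit-+order r (k % order) (k / order))

    orbit-order : ∀ r → orbit r order ≡ r % t
    orbit-order r = %-*-≡1 t r p^order

    orbit-≢0 : ∀ {r} → ¬ t ∣ r → ∀ k → orbit r k ≢ 0
    orbit-≢0 t∤r k ≡0 = t∤* t∤r (t∤p^ k) (m%n≡0⇒n∣m _ t ≡0)

    orbit-no-repeat : ∀ {r} → ¬ t ∣ r → ∀ {k k′} → k < k′ → k′ < order → orbit r k ≢ orbit r k′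
    orbit-no-repeat {r} t∤r {k} {k′} k<k′ k′<o eq =
      order-minimal (k′ ∸ k) (m<n⇒0<n∸m k<k′) (≤-<-trans (m∸n≤m k′ k) k′<o)
        (p^∸≡1 (<⇒≤ k<k′) (%-cancelˡ-* t r (cancellable t∤r) eq))

    orbit-injective : ∀ {r} → ¬ t ∣ r → ∀ {k k′} → k < order → k′ < order → orbit r k ≡ orbit r k′ → k ≡ k′
    orbit-injective t∤r {k} {k′} k<o k′<o eq with <-cmp k k′
    ... | tri≈ _ k≡k′ _ = k≡k′
    ... | tri< k<k′ _ _ = ⊥-elim (orbit-no-repeat t∤r k<k′ k′<o eq)
    ... | tri> _ _ k′<k = ⊥-elim (orbit-no-repeat t∤r k′<k k<o (sym eq))

    Invariant : (ℕ → ℕ) → Set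
    Invariant g = ∀ u → u < t → g u ≡ g ((u * p) % t)

    invariant-orbit : ∀ {g} → Invariant g → ∀ {r} → r < t → ∀ k → g (orbit r k) ≡ g r
    invariant-orbit {g} inv r<t zero    = cong g (orbit-zero r<t)
    invariant-orbit {g} inv {r} r<t (suc k) = begin
      g (orbit r (suc k))          ≡⟨ cong g (orbit-suc r k) ⟨
      g ((orbit r k * p) % t)      ≡⟨ inv (orbit r k) (m%n<n (r * p ^ k) t) ⟨
      g (orbit r k)                ≡⟨ invariant-orbit inv r<t k ⟩
      g r                          ∎
      where open ≡-Reasoning

    ≤-invariant⇒invariant : ∀ {g} → (∀ u → u < t → g u ≤ g ((u * p) % t)) → Invariant g
    ≤-invariant⇒invariant {g} g≤gp u u<t = ≤-antisym (g≤gp u u<t) (begin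
      g ((u * p) % t)                  ≡⟨ cong (λ z → g ((z * p) % t)) (orbit-zero u<t) ⟨
      g ((orbit u 0 * p) % t)          ≡⟨ cong g (orbit-suc u 0) ⟩
      g (orbit u 1)                    ≤⟨ ≤-orbit (orbit u 1) (m%n<n (u * p ^ 1) t) (order ∸ 1) ⟩
      g (orbit (orbit u 1) (order ∸ 1)) ≡⟨ cong g (orbit-orbit u 1 (order ∸ 1)) ⟩
      g (orbit u order)                ≡⟨ cong g (trans (orbit-order u) (m<n⇒m%n≡m u<t)) ⟩
      g u                              ∎)
      where
      open ≤-Reasoning
      ≤-orbit : ∀ r → r < t → ∀ k → g r ≤ g (orbit r k)
      ≤-orbit r r<t zero    = ≤-reflexive (cong g (sym (orbit-zero r<t)))
      ≤-orbit r r<t (suc k) = ≤-trans (≤-orbit r r<t k)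
        (≤-trans (g≤gp (orbit r k) (m%n<n (r * p ^ k) t)) (≤-reflexive (cong g (orbit-suc r k))))

    hits : ℕ → ℕ → ℕ
    hits r u = sumBelow order (λ k → 𝟙 ⌊ orbit r k ≟ u ⌋)

    sumBelow-hits : ∀ {g} → Invariant g → ∀ {r} → r < t → sumBelow t (λ u → hits r u * g u) ≡ order * g r
    sumBelow-hits {g} inv {r} r<t = begin
      sumBelow t (λ u → hits r u * g u)
        ≡⟨ sumBelow-cong t (λ u _ → sumBelow-*ʳ order (g u) (λ k → 𝟙 ⌊ orbit r k ≟ u ⌋)) ⟨
      sumBelow t (λ u → sumBelow order (λ k → 𝟙 ⌊ orbit r k ≟ u ⌋ * g u))
        ≡⟨ sumBelow-comm t order _ ⟩
      sumBelow order (λ k → sumBelow t (λ u → 𝟙 ⌊ orbit r k ≟ u ⌋ * g u))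
        ≡⟨ sumBelow-cong order (λ k _ → trans (sumBelow-cong t (λ u _ → cong (λ b → 𝟙 b * g u) (⌊≟⌋-sym _ u)))
                                               (sumBelow-select t g (m%n<n (r * p ^ k) t))) ⟩
      sumBelow order (λ k → g (orbit r k))
        ≡⟨ sumBelow-cong order (λ k _ → invariant-orbit inv r<t k) ⟩
      sumBelow order (λ _ → g r)
        ≡⟨ sumBelow-const order (g r) ⟩
      order * g r ∎
      where open ≡-Reasoning

    hits-zero : ∀ {r} → ¬ t ∣ r → hits r 0 ≡ 0
    hits-zero t∤r = sumBelow-0 order (λ k _ → cong 𝟙 (⌊≟⌋-≢ (orbit-≢0 t∤r k)))

    hits-orbit : ∀ {r} → ¬ t ∣ r → ∀ {k} → k < order → hits r (orbit r k) ≡ 1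
    hits-orbit {r} t∤r {k} k<o = begin
      sumBelow order (λ k′ → 𝟙 ⌊ orbit r k′ ≟ orbit r k ⌋) ≡⟨ sumBelow-cong order (λ k′ k′<o → same k′<o) ⟩
      sumBelow order (λ k′ → 𝟙 ⌊ k′ ≟ k ⌋ * 1)              ≡⟨ sumBelow-select order (λ _ → 1) k<o ⟩
      1                                                      ∎
      where
      open ≡-Reasoning
      same : ∀ {k′} → k′ < order → 𝟙 ⌊ orbit r k′ ≟ orbit r k ⌋ ≡ 𝟙 ⌊ k′ ≟ k ⌋ * 1
      same k′<o = trans (cong 𝟙 (⌊≟⌋-injective (orbit r) (orbit-injective t∤r k′<o k<o))) (sym (*-identityʳ _))

    module Representatives (s : ℕ) (reps : Fin s → ℕ)
      (reps-range : ∀ j → 1 ≤ reps j × reps j < t)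
      (reps-distinct : ∀ j k → SameOrbit p t (reps j) (reps k) → j ≡ k)
      (reps-cover : ∀ u → 1 ≤ u → u < t → ∃ λ j → SameOrbit p t (reps j) u) where

      t∤reps : ∀ j → ¬ t ∣ reps j
      t∤reps j = t∤nonzero (proj₁ (reps-range j)) (proj₂ (reps-range j))

      hits-others : ∀ {j₀ k₀} → k₀ < order → ∀ j → j ≢ j₀ → hits (reps j) (orbit (reps j₀) k₀) ≡ 0
      hits-others {j₀} {k₀} k₀<o j j≢j₀ = sumBelow-0 order (λ k _ → cong 𝟙 (⌊≟⌋-≢ (λ eq → j≢j₀ (reps-distinct j j₀ (k + (order ∸ k₀) , back {k} eq)))))
        where
        back : ∀ {k} → orbit (reps j) k ≡ orbit (reps j₀) k₀ → reps j₀ % t ≡ orbit (reps j) (k + (order ∸ k₀))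
        back {k} eq = begin
          reps j₀ % t                                  ≡⟨ orbit-order (reps j₀) ⟨
          orbit (reps j₀) order                        ≡⟨ cong (orbit (reps j₀)) (m+[n∸m]≡n (<⇒≤ k₀<o)) ⟨
          orbit (reps j₀) (k₀ + (order ∸ k₀))          ≡⟨ orbit-orbit (reps j₀) k₀ (order ∸ k₀) ⟨
          orbit (orbit (reps j₀) k₀) (order ∸ k₀)      ≡⟨ cong (λ v → orbit v (order ∸ k₀)) eq ⟨
          orbit (orbit (reps j) k) (order ∸ k₀)        ≡⟨ orbit-orbit (reps j) k (order ∸ k₀) ⟩
          orbit (reps j) (k + (order ∸ k₀))            ∎
          where open ≡-Reasoning

      finSum-hits : ∀ u → u < t → finSum (λ j → hits (reps j) u) ≡ 𝟙 ⌊ 1 ≤? u ⌋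
      finSum-hits zero _ = trans (finSum-cong s (λ j → hits-zero (t∤reps j))) (trans (finSum-const s 0) (*-zeroʳ s))
      finSum-hits (suc u) u<t with reps-cover (suc u) (s≤s z≤n) u<t
      ... | j₀ , k , u≡ = trans (finSum-cong s (λ j → cong (hits (reps j)) u≡orbit))
        (finSum-select s _ j₀ (hits-orbit (t∤reps j₀) (m%n<n k order)) (hits-others (m%n<n k order)))
        where
        u≡orbit : suc u ≡ orbit (reps j₀) (k % order)
        u≡orbit = trans (sym (m<n⇒m%n≡m u<t)) (trans u≡ (orbit-%order (reps j₀) k))

      sumBelow-nonzero : ∀ {g} → Invariant g → sumBelow t₁ (λ i → g (suc i)) ≡ order * finSum (λ j → g (reps j))
      sumBelow-nonzero {g} inv = begin
        sumBelow t₁ (λ i → g (suc i))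
          ≡⟨ sumBelow-cong t₁ (λ i _ → +-identityʳ (g (suc i))) ⟨
        0 + sumBelow t₁ (λ i → 𝟙 ⌊ 1 ≤? suc i ⌋ * g (suc i))
          ≡⟨ sumBelow-suc t₁ (λ u → 𝟙 ⌊ 1 ≤? u ⌋ * g u) ⟨
        sumBelow t (λ u → 𝟙 ⌊ 1 ≤? u ⌋ * g u)
          ≡⟨ sumBelow-cong t (λ u u<t → cong (_* g u) (finSum-hits u u<t)) ⟨
        sumBelow t (λ u → finSum (λ j → hits (reps j) u) * g u)
          ≡⟨ sumBelow-cong t (λ u _ → trans (*-comm _ (g u)) (sym (finSum-*ˡ s (g u) _))) ⟩
        sumBelow t (λ u → finSum (λ j → g u * hits (reps j) u))
          ≡⟨ finSum-sumBelow s t _ ⟨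
        finSum (λ j → sumBelow t (λ u → g u * hits (reps j) u))
          ≡⟨ finSum-cong s (λ j → trans (sumBelow-cong t (λ u _ → *-comm (g u) _))
                                        (sumBelow-hits inv (proj₂ (reps-range j)))) ⟩
        finSum (λ j → order * g (reps j))
          ≡⟨ finSum-*ˡ s order _ ⟩
        order * finSum (λ j → g (reps j)) ∎
        where open ≡-Reasoning

      t₁≡order*s : t₁ ≡ order * s
      t₁≡order*s = begin
        t₁                             ≡⟨ *-identityʳ t₁ ⟨
        t₁ * 1                         ≡⟨ sumBelow-const t₁ 1 ⟨
        sumBelow t₁ (λ _ → 1)          ≡⟨ sumBelow-nonzero (λ _ _ → refl) ⟩
        order * finSum {s} (λ _ → 1)   ≡⟨ cong (order *_) (trans (finSum-const s 1) (*-identityʳ s)) ⟩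
        order * s                      ∎
        where open ≡-Reasoning

      orbit-decomposition : ∀ {g} → Invariant g → s * sumBelow t₁ (λ i → g (suc i)) ≡ t₁ * finSum (λ j → g (reps j))
      orbit-decomposition {g} inv = begin
        s * sumBelow t₁ (λ i → g (suc i))   ≡⟨ cong (s *_) (sumBelow-nonzero inv) ⟩
        s * (order * Σreps)                 ≡⟨ *-assoc s order Σreps ⟨
        s * order * Σreps                   ≡⟨ cong (_* Σreps) (trans (*-comm s order) (sym t₁≡order*s)) ⟩
        t₁ * Σreps                          ∎
        where
        open ≡-Reasoning
        Σreps = finSum (λ j → g (reps j))

module FiniteFields where
  open import Algebra.Bundles using (CommutativeRing)
  open import Data.Nat as ℕ using (ℕ; zero; suc; s≤s; z≤n; _!)
  import Data.Nat.Properties as ℕ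
  open import Data.Nat.Primality using (Prime; euclidsLemma; prime⇒nonTrivial)
  open import Data.Nat.Divisibility using (_∣_; divides; ∣1⇒≡1; ∣⇒≤)
  open import Data.Nat.Combinatorics using (_C_; nCn≡1; k![n∸k]!∣n!)
  open import Data.Nat.Combinatorics.Specification using (nCk≡n!/k![n-k]!)
  open import Data.Nat.DivMod using (m/n*n≡m)
  open import Data.Fin using (Fin; toℕ; fromℕ; inject₁)
  import Data.Fin.Properties as Fin
  open import Data.Fin.Permutation using (permutation)
  open import Data.Product using (∃; _×_; _,_; proj₁; proj₂)
  open import Data.Sum using (_⊎_; inj₁; inj₂)
  open import Data.Empty using (⊥-elim)
  open import Relation.Nullary using (¬_; yes; no)
  import Relation.Binary.PropositionalEquality as ≡
  open ≡ using (_≡_)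
  open import Defs using (IsFieldOfOrder; pow)

  prime∤! : ∀ {p} → Prime p → ∀ m → m ℕ.< p → ¬ p ∣ m !
  prime∤! {p} p-prime zero    m<p p∣1 = ℕ.<-irrefl (≡.sym (∣1⇒≡1 p∣1)) (ℕ.nonTrivial⇒n>1 p {{prime⇒nonTrivial p-prime}})
  prime∤! {p} p-prime (suc m) m<p p∣m! with euclidsLemma (suc m) (m !) p-prime p∣m!
  ... | inj₁ p∣1+m = ℕ.<-irrefl ≡.refl (ℕ.≤-trans m<p (∣⇒≤ p∣1+m))
  ... | inj₂ p∣m!  = prime∤! p-prime m (ℕ.<-trans (ℕ.n<1+n m) m<p) p∣m!

  prime∣prime-choose : ∀ {p} → Prime p → ∀ k → 0 ℕ.< k → k ℕ.< p → p ∣ p C k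
  prime∣prime-choose {p} p-prime k 0<k k<p with euclidsLemma (p C k) (k ! ℕ.* (p ℕ.∸ k) !) p-prime p∣p!
    where
    instance
      k!*[p∸k]!≢0 : ℕ.NonZero (k ! ℕ.* (p ℕ.∸ k) !)
      k!*[p∸k]!≢0 = k ℕ.!* (p ℕ.∸ k) !≢0
    p∣p! : p ∣ (p C k) ℕ.* (k ! ℕ.* (p ℕ.∸ k) !)
    p∣p! = ≡.subst (p ∣_) (≡.sym (≡.trans (≡.cong (ℕ._* (k ! ℕ.* (p ℕ.∸ k) !)) (nCk≡n!/k![n-k]! (ℕ.<⇒≤ k<p)))
                                         (m/n*n≡m (k![n∸k]!∣n! (ℕ.<⇒≤ k<p)))))
                          (n∣n! p (ℕ.<-trans 0<k k<p))
      where
      n∣n! : ∀ n → 0 ℕ.< n → n ∣ n !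
      n∣n! (suc n) _ = divides (n !) (ℕ.*-comm (suc n) (n !))
  ... | inj₁ p∣C = p∣C
  ... | inj₂ p∣k!*[p∸k]! with euclidsLemma (k !) ((p ℕ.∸ k) !) p-prime p∣k!*[p∸k]!
  ...   | inj₁ p∣k!     = ⊥-elim (prime∤! p-prime k k<p p∣k!)
  ...   | inj₂ p∣[p∸k]! = ⊥-elim (prime∤! p-prime (p ℕ.∸ k) (ℕ.∸-monoʳ-< 0<k (ℕ.<⇒≤ k<p)) p∣[p∸k]!)

  module FieldProperties {c ℓ} (F : CommutativeRing c ℓ) {M : ℕ} (isF : IsFieldOfOrder F M) where

    open CommutativeRing F
    open IsFieldOfOrder isF renaming (_≟_ to _≈?_)
    open import Relation.Binary.Reasoning.Setoid setoid
    open import Algebra.Properties.CommutativeSemiring.Exp commutativeSemiring public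
      using (_^_; ^-congˡ; ^-homo-*; ^-assocʳ; ^-distrib-*)
    open import Algebra.Properties.Group +-group public using (x∙y⁻¹≈ε⇒x≈y; x≈y⇒x∙y⁻¹≈ε; inverseʳ-unique)
      renaming (∙-cancelˡ to +-cancelˡ)
    open import Algebra.Properties.AbelianGroup +-abelianGroup public using (⁻¹-∙-comm)
    open import Algebra.Properties.CommutativeSemigroup +-commutativeSemigroup public using (interchange)
    open import Algebra.Properties.Monoid.Mult +-monoid using (×-congʳ; ×-congˡ; ×-homo-1; ×-assocˡ) renaming (_×_ to _×ₘ_)
    open import Algebra.Properties.Semiring.Mult semiring using (×1-homo-*; ×-assoc-*)
    open import Algebra.Properties.CommutativeMonoid.Sum +-commutativeMonoid
      using (sum; sum-permute; ∑-distrib-+; sum-replicate; sum-cong-≋)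

    [x-y]-[u-v]≈[x-u]-[y-v] : ∀ x y u v → (x - y) - (u - v) ≈ (x - u) - (y - v)
    [x-y]-[u-v]≈[x-u]-[y-v] x y u v = begin
      (x - y) - (u - v)              ≈⟨ +-congˡ (⁻¹-∙-comm u (- v)) ⟨
      (x - y) + (- u + - - v)        ≈⟨ interchange x (- y) (- u) (- - v) ⟩
      (x - u) + (- y + - - v)        ≈⟨ +-congˡ (⁻¹-∙-comm y (- v)) ⟩
      (x - u) - (y - v)              ∎

    pow≈^ : ∀ x k → pow F x k ≈ x ^ k
    pow≈^ x zero    = refl
    pow≈^ x (suc k) = *-congˡ (pow≈^ x k)

    1#^ : ∀ k → 1# ^ k ≈ 1#
    1#^ zero    = refl
    1#^ (suc k) = trans (*-identityˡ _) (1#^ k)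

    inverseˡ : ∀ {x} → x ≉ 0# → ∃ λ y → y * x ≈ 1#
    inverseˡ {x} x≉0 with inverse x x≉0
    ... | y , xy≈1 = y , trans (*-comm y x) xy≈1

    *-cancelˡ : ∀ {z x y} → z ≉ 0# → z * x ≈ z * y → x ≈ y
    *-cancelˡ {z} {x} {y} z≉0 zx≈zy with inverseˡ z≉0
    ... | z⁻¹ , z⁻¹z≈1 = begin
      x                ≈⟨ *-identityˡ x ⟨
      1# * x           ≈⟨ *-congʳ z⁻¹z≈1 ⟨
      (z⁻¹ * z) * x    ≈⟨ *-assoc z⁻¹ z x ⟩
      z⁻¹ * (z * x)    ≈⟨ *-congˡ zx≈zy ⟩
      z⁻¹ * (z * y)    ≈⟨ *-assoc z⁻¹ z y ⟨
      (z⁻¹ * z) * y    ≈⟨ *-congʳ z⁻¹z≈1 ⟩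
      1# * y           ≈⟨ *-identityˡ y ⟩
      y                ∎

    zero-product : ∀ {x y} → x * y ≈ 0# → x ≈ 0# ⊎ y ≈ 0#
    zero-product {x} {y} xy≈0 with x ≈? 0#
    ... | yes x≈0 = inj₁ x≈0
    ... | no x≉0  = inj₂ (*-cancelˡ x≉0 (trans xy≈0 (sym (zeroʳ x))))

    *-≉0 : ∀ {x y} → x ≉ 0# → y ≉ 0# → x * y ≉ 0#
    *-≉0 x≉0 y≉0 xy≈0 with zero-product xy≈0
    ... | inj₁ x≈0 = x≉0 x≈0
    ... | inj₂ y≈0 = y≉0 y≈0

    ^-≉0 : ∀ {x} k → x ≉ 0# → x ^ k ≉ 0#
    ^-≉0 zero    x≉0 = 1≉0
    ^-≉0 (suc k) x≉0 = *-≉0 x≉0 (^-≉0 k x≉0)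

    M×1#≈0# : M ×ₘ 1# ≈ 0#
    M×1#≈0# = sym (+-cancelˡ (sum enum) _ _ (begin
      sum enum + 0#                      ≈⟨ +-identityʳ _ ⟩
      sum enum                           ≈⟨ sum-permute enum (permutation (shift 1#) (shift (- 1#)) (shift-inverse (-‿inverseˡ 1#)) (shift-inverse (-‿inverseʳ 1#))) ⟩
      sum {M} (λ j → enum (shift 1# j))  ≈⟨ sum-cong-≋ {M} (λ j → proj₂ (enum-surj _)) ⟩
      sum {M} (λ j → enum j + 1#)        ≈⟨ ∑-distrib-+ {M} enum (λ _ → 1#) ⟩
      sum enum + sum {M} (λ _ → 1#)      ≈⟨ +-congˡ (sum-replicate M) ⟩
      sum enum + M ×ₘ 1#                 ∎))
      where
      shift : Carrier → Fin M → Fin M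
      shift c j = proj₁ (enum-surj (enum j + c))
      shift-inverse : ∀ {c d} → d + c ≈ 0# → ∀ j → shift c (shift d j) ≡ j
      shift-inverse {c} {d} d+c≈0 j = enum-inj _ _ (begin
        enum (shift c (shift d j))     ≈⟨ proj₂ (enum-surj _) ⟩
        enum (shift d j) + c           ≈⟨ +-congʳ (proj₂ (enum-surj _)) ⟩
        (enum j + d) + c               ≈⟨ +-assoc _ d c ⟩
        enum j + (d + c)               ≈⟨ +-congˡ d+c≈0 ⟩
        enum j + 0#                    ≈⟨ +-identityʳ _ ⟩
        enum j                         ∎)

    ^×1# : ∀ p e → (p ℕ.^ e) ×ₘ 1# ≈ (p ×ₘ 1#) ^ e
    ^×1# p zero    = ×-homo-1 1#
    ^×1# p (suc e) = trans (×1-homo-* p (p ℕ.^ e)) (*-congˡ (^×1# p e))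

    characteristic : ∀ {p e} → M ≡ p ℕ.^ e → p ×ₘ 1# ≈ 0#
    characteristic {p} {e} M≡p^e with (p ×ₘ 1#) ≈? 0#
    ... | yes p×1≈0 = p×1≈0
    ... | no p×1≉0  = ⊥-elim (^-≉0 e p×1≉0 (trans (sym (^×1# p e)) (trans (×-congˡ (≡.sym M≡p^e)) M×1#≈0#)))

    module Frobenius {p} (p-prime : Prime p) (p×1≈0 : p ×ₘ 1# ≈ 0#) where
      open import Algebra.Properties.CommutativeSemiring.Binomial commutativeSemiring using (theorem; binomialTerm)
      open import Algebra.Properties.Monoid.Sum +-monoid using (sum-init-last; sum-replicate-zero)

      p×≈0 : ∀ z → p ×ₘ z ≈ 0#
      p×≈0 z = begin
        p ×ₘ z          ≈⟨ ×-congʳ p (*-identityˡ z) ⟨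
        p ×ₘ (1# * z)   ≈⟨ ×-assoc-* p 1# z ⟨
        (p ×ₘ 1#) * z   ≈⟨ *-congʳ p×1≈0 ⟩
        0# * z          ≈⟨ zeroˡ z ⟩
        0#              ∎

      ×0# : ∀ n → n ×ₘ 0# ≈ 0#
      ×0# zero    = refl
      ×0# (suc n) = trans (+-identityˡ _) (×0# n)

      inner-binomial≈0 : ∀ k z → 0 ℕ.< k → k ℕ.< p → (p C k) ×ₘ z ≈ 0#
      inner-binomial≈0 k z 0<k k<p with prime∣prime-choose p-prime k 0<k k<p
      ... | divides m pCk≡m*p = begin
        (p C k) ×ₘ z       ≡⟨ ≡.cong (_×ₘ z) pCk≡m*p ⟩
        (m ℕ.* p) ×ₘ z     ≈⟨ ×-assocˡ z m p ⟨
        m ×ₘ (p ×ₘ z)      ≈⟨ ×-congʳ m (p×≈0 z) ⟩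
        m ×ₘ 0#            ≈⟨ ×0# m ⟩
        0#                 ∎

      ^p-distrib-+ : ∀ x y → (x + y) ^ p ≈ x ^ p + y ^ p
      ^p-distrib-+ = binomial-collapse (p ℕ.∸ 2) p≡2+[p∸2]
        where
        p≡2+[p∸2] : p ≡ suc (suc (p ℕ.∸ 2))
        p≡2+[p∸2] = ≡.sym (ℕ.m+[n∸m]≡n (ℕ.nonTrivial⇒n>1 p {{prime⇒nonTrivial p-prime}}))
        binomial-collapse : ∀ p′ → p ≡ suc (suc p′) → ∀ x y → (x + y) ^ p ≈ x ^ p + y ^ p
        binomial-collapse p′ ≡.refl x y = begin
          (x + y) ^ p                                        ≈⟨ theorem p x y ⟩
          term Fin.zero + sum {p} (λ i → term (Fin.suc i))   ≈⟨ +-congˡ (sum-init-last {suc p′} (λ i → term (Fin.suc i))) ⟩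
          term Fin.zero + (sum {suc p′} (λ i → term (Fin.suc (inject₁ i))) + term (Fin.suc (fromℕ (suc p′))))
            ≈⟨ +-cong first (+-cong (trans (sum-cong-≋ {suc p′} middle) (sum-replicate-zero (suc p′))) last) ⟩
          y ^ p + (0# + x ^ p)                               ≈⟨ trans (+-congˡ (+-identityˡ _)) (+-comm _ _) ⟩
          x ^ p + y ^ p                                      ∎
          where
          term = binomialTerm x y p
          first : term Fin.zero ≈ y ^ p
          first = trans (+-identityʳ _) (*-identityˡ _)
          last : term (Fin.suc (fromℕ (suc p′))) ≈ x ^ p
          last = top (toℕ (Fin.suc (fromℕ (suc p′)))) (≡.cong suc (Fin.toℕ-fromℕ (suc p′)))
            where
            top : ∀ k → k ≡ p → (p C k) ×ₘ (x ^ k * y ^ (p ℕ.∸ k)) ≈ x ^ p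
            top .p ≡.refl = begin
              (p C p) ×ₘ (x ^ p * y ^ (p ℕ.∸ p)) ≡⟨ ≡.cong (_×ₘ (x ^ p * y ^ (p ℕ.∸ p))) (nCn≡1 p) ⟩
              1 ×ₘ (x ^ p * y ^ (p ℕ.∸ p))       ≈⟨ +-identityʳ _ ⟩
              x ^ p * y ^ (p ℕ.∸ p)              ≡⟨ ≡.cong (λ k → x ^ p * y ^ k) (ℕ.n∸n≡0 p) ⟩
              x ^ p * 1#                         ≈⟨ *-identityʳ _ ⟩
              x ^ p                              ∎
          middle : ∀ i → term (Fin.suc (inject₁ i)) ≈ 0#
          middle i = inner-binomial≈0 (suc (toℕ (inject₁ i))) _ (s≤s z≤n)
            (s≤s (≡.subst (ℕ._< suc p′) (≡.sym (Fin.toℕ-inject₁ i)) (Fin.toℕ<n i)))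

      ^p^e-distrib-+ : ∀ e x y → (x + y) ^ (p ℕ.^ e) ≈ x ^ (p ℕ.^ e) + y ^ (p ℕ.^ e)
      ^p^e-distrib-+ zero    x y = trans (*-identityʳ _) (sym (+-cong (*-identityʳ x) (*-identityʳ y)))
      ^p^e-distrib-+ (suc e) x y = begin
        (x + y) ^ (p ℕ.* p ℕ.^ e)                        ≈⟨ ^-assocʳ (x + y) p (p ℕ.^ e) ⟨
        ((x + y) ^ p) ^ (p ℕ.^ e)                        ≈⟨ ^-congˡ (p ℕ.^ e) (^p-distrib-+ x y) ⟩
        (x ^ p + y ^ p) ^ (p ℕ.^ e)                      ≈⟨ ^p^e-distrib-+ e (x ^ p) (y ^ p) ⟩
        (x ^ p) ^ (p ℕ.^ e) + (y ^ p) ^ (p ℕ.^ e)        ≈⟨ +-cong (^-assocʳ x p (p ℕ.^ e)) (^-assocʳ y p (p ℕ.^ e)) ⟩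
        x ^ (p ℕ.* p ℕ.^ e) + y ^ (p ℕ.* p ℕ.^ e)        ∎

module ProjectivePlane where
  open import Level using (_⊔_)
  open import Algebra.Bundles using (CommutativeRing)
  open import Data.Nat as ℕ using (ℕ; zero; suc; s≤s; z≤n; _<_; _≤_; NonZero)
  import Data.Nat.Properties as ℕ
  open import Data.Nat.DivMod using (_%_; _/_; m%n<n; m≡m%n+[m/n]*n; m<n⇒m%n≡m; %-distribˡ-+; m%n%n≡m%n; m∣n⇒o%n%m≡o%m)
  open import Data.Nat.Divisibility using (_∣_; divides; m%n≡0⇒n∣m)
  open import Data.Nat.Primality using (Prime)
  open import Data.Nat.Solver using (module +-*-Solver)
  open import Data.Fin using (Fin; toℕ; fromℕ<; combine; remQuot)
  import Data.Fin.Properties as Fin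
  open import Data.Product using (∃; _×_; _,_; proj₁; proj₂)
  open import Data.Sum using (inj₁; inj₂)
  open import Data.Empty using (⊥-elim)
  open import Data.Bool using (Bool; true; T; T?; _∧_; not)
  open import Data.Bool.Properties using (T-∧; T-≡)
  open import Function.Bundles using (Equivalence)
  open import Relation.Nullary.Decidable using (⌊_⌋; toWitness; fromWitness)
  open import Function.Definitions using (Injective)
  open import Relation.Nullary using (¬_; yes; no)
  open import Relation.Binary.Definitions using (tri<; tri≈; tri>)
  import Relation.Binary.PropositionalEquality as ≡
  open ≡ using (_≡_)
  open import Defs
  open FiniteFields
  open FiniteSums using (⌊≟⌋-≢)
  open Counting
  open +-*-Solver using (solve; _:+_; _:*_; _:=_; con)

  module SingerCycle {c ℓ} (F : CommutativeRing c ℓ) (q₂ : ℕ)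
    (isF : IsFieldOfOrder F (suc (suc q₂) ℕ.^ 3))
    (α : CommutativeRing.Carrier F) (α-primitive : IsPrimitive F (suc (suc q₂) ℕ.^ 3) α) where

    open CommutativeRing F
    open IsFieldOfOrder isF renaming (_≟_ to _≈?_)
    open FieldProperties F isF
    open import Algebra.Properties.Ring ring using (-‿distribˡ-*; -‿distribʳ-*; [y-z]x≈yx-zx; x[y-z]≈xy-xz)
    open import Relation.Binary.Reasoning.Setoid setoid

    q₁ q n : ℕ
    q₁ = suc q₂
    q  = suc q₁
    n  = suc (q ℕ.* q ℕ.+ q)

    -- Kept opaque: unfolded, N is a large unary numeral that makes unification crawl.
    opaque
      N : ℕ
      N = q₁ ℕ.* n

      N≡q₁*n : N ≡ q₁ ℕ.* n
      N≡q₁*n = ≡.refl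

    instance
      N≢0 : NonZero N
      N≢0 = ≡.subst NonZero (≡.sym N≡q₁*n) (ℕ.m*n≢0 q₁ n)

    q³≡1+N : q ℕ.^ 3 ≡ suc N
    q³≡1+N = ≡.trans (solve 1 (λ m → (con 2 :+ m) :* ((con 2 :+ m) :* ((con 2 :+ m) :* con 1)) :=
                  con 1 :+ (con 1 :+ m) :* (con 1 :+ ((con 2 :+ m) :* (con 2 :+ m) :+ (con 2 :+ m)))) ≡.refl q₂)
                     (≡.cong suc (≡.sym N≡q₁*n))

    index : Carrier → ℕ
    index x = toℕ (proj₁ (enum-surj x))

    index<1+N : ∀ x → index x < suc N
    index<1+N x = ≡.subst (index x <_) q³≡1+N (Fin.toℕ<n (proj₁ (enum-surj x)))

    index-injective : ∀ {x y} → index x ≡ index y → x ≈ y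
    index-injective {x} {y} eq =
      trans (sym (proj₂ (enum-surj x))) (trans (reflexive (≡.cong enum (Fin.toℕ-injective eq))) (proj₂ (enum-surj y)))

    α≉0 : α ≉ 0#
    α≉0 = proj₁ α-primitive

    α^≉0 : ∀ k → α ^ k ≉ 0#
    α^≉0 k = ^-≉0 k α≉0

    α^≉1 : ∀ {k} → 0 < k → k < N → α ^ k ≉ 1#
    α^≉1 {k} 0<k k<N α^k≈1 = proj₂ α-primitive k 0<k (≡.subst (k <_) (≡.cong (ℕ._∸ 1) (≡.sym q³≡1+N)) k<N)
      (trans (pow≈^ α k) α^k≈1)

    α^-split : ∀ {i j} → i ≤ j → α ^ j ≈ α ^ i * α ^ (j ℕ.∸ i)
    α^-split {i} {j} i≤j = trans (reflexive (≡.cong (α ^_) (≡.sym (ℕ.m+[n∸m]≡n i≤j)))) (^-homo-* α i (j ℕ.∸ i))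

    α^-no-repeat : ∀ {i j} → i < j → j < N → α ^ i ≉ α ^ j
    α^-no-repeat {i} {j} i<j j<N eq = α^≉1 (ℕ.m<n⇒0<n∸m i<j) (ℕ.≤-<-trans (ℕ.m∸n≤m j i) j<N)
      (sym (*-cancelˡ (α^≉0 i) (trans (*-identityʳ _) (trans eq (α^-split (ℕ.<⇒≤ i<j))))))

    α^-injective : ∀ {i j} → i < N → j < N → α ^ i ≈ α ^ j → i ≡ j
    α^-injective {i} {j} i<N j<N eq with ℕ.<-cmp i j
    ... | tri≈ _ i≡j _ = i≡j
    ... | tri< i<j _ _ = ⊥-elim (α^-no-repeat i<j j<N eq)
    ... | tri> _ _ j<i = ⊥-elim (α^-no-repeat j<i i<N (sym eq))

    -- Otherwise 0, x, α⁰, …, α^(N-1) would be N + 2 distinct elements of a field with N + 1 elements.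
    α^-surjective : ∀ {x} → x ≉ 0# → ∃ λ i → i < N × x ≈ α ^ i
    α^-surjective {x} x≉0 with Fin.any? {n = N} (λ i → x ≈? (α ^ toℕ i))
    ... | yes (i , x≈α^i) = toℕ i , Fin.toℕ<n i , x≈α^i
    ... | no ¬power       = ⊥-elim (Fin.<⇒notInjective {f = f} (ℕ.n<1+n (suc N)) f-injective)
      where
      element : Fin (suc (suc N)) → Carrier
      element Fin.zero             = 0#
      element (Fin.suc Fin.zero)   = x
      element (Fin.suc (Fin.suc i)) = α ^ toℕ i
      f : Fin (suc (suc N)) → Fin (suc N)
      f i = fromℕ< (index<1+N (element i))
      element-injective : ∀ i j → element i ≈ element j → i ≡ j
      element-injective Fin.zero              Fin.zero              _ = ≡.refl
      element-injective Fin.zero              (Fin.suc Fin.zero)    e = ⊥-elim (x≉0 (sym e))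
      element-injective Fin.zero              (Fin.suc (Fin.suc j)) e = ⊥-elim (α^≉0 (toℕ j) (sym e))
      element-injective (Fin.suc Fin.zero)    Fin.zero              e = ⊥-elim (x≉0 e)
      element-injective (Fin.suc Fin.zero)    (Fin.suc Fin.zero)    _ = ≡.refl
      element-injective (Fin.suc Fin.zero)    (Fin.suc (Fin.suc j)) e = ⊥-elim (¬power (j , e))
      element-injective (Fin.suc (Fin.suc i)) Fin.zero              e = ⊥-elim (α^≉0 (toℕ i) e)
      element-injective (Fin.suc (Fin.suc i)) (Fin.suc Fin.zero)    e = ⊥-elim (¬power (i , sym e))
      element-injective (Fin.suc (Fin.suc i)) (Fin.suc (Fin.suc j)) e =
        ≡.cong (λ k → Fin.suc (Fin.suc k)) (Fin.toℕ-injective (α^-injective (Fin.toℕ<n i) (Fin.toℕ<n j) e))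
      f-injective : Injective _≡_ _≡_ f
      f-injective {i} {j} fi≡fj = element-injective i j (index-injective
        (≡.trans (≡.sym (Fin.toℕ-fromℕ< _)) (≡.trans (≡.cong toℕ fi≡fj) (Fin.toℕ-fromℕ< _))))

    α^N≈1 : α ^ N ≈ 1#
    α^N≈1 with α^-surjective (α^≉0 N)
    ... | zero  , _   , α^N≈1 = α^N≈1
    ... | suc i , i<N , α^N≈α^i = ⊥-elim (α^≉1 (ℕ.m<n⇒0<n∸m i<N) (ℕ.∸-monoʳ-< {N} {suc i} {0} (s≤s z≤n) (ℕ.<⇒≤ i<N))
      (sym (*-cancelˡ (α^≉0 (suc i)) (trans (*-identityʳ _) (trans (sym α^N≈α^i) (α^-split (ℕ.<⇒≤ i<N)))))))

    α^-+N : ∀ i k → α ^ (i ℕ.+ k ℕ.* N) ≈ α ^ i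
    α^-+N i k = begin
      α ^ (i ℕ.+ k ℕ.* N)          ≈⟨ ^-homo-* α i (k ℕ.* N) ⟩
      α ^ i * α ^ (k ℕ.* N)        ≡⟨ ≡.cong (λ m → α ^ i * α ^ m) (ℕ.*-comm k N) ⟩
      α ^ i * α ^ (N ℕ.* k)        ≈⟨ *-congˡ (^-assocʳ α N k) ⟨
      α ^ i * (α ^ N) ^ k          ≈⟨ *-congˡ (trans (^-congˡ k α^N≈1) (1#^ k)) ⟩
      α ^ i * 1#                   ≈⟨ *-identityʳ _ ⟩
      α ^ i                        ∎

    α^-%N : ∀ i → α ^ i ≈ α ^ (i % N)
    α^-%N i = trans (reflexive (≡.cong (α ^_) (m≡m%n+[m/n]*n i N))) (α^-+N (i % N) (i / N))

    α^≈⇒%N : ∀ {i j} → α ^ i ≈ α ^ j → i % N ≡ j % N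
    α^≈⇒%N {i} {j} eq = α^-injective (m%n<n i N) (m%n<n j N) (trans (sym (α^-%N i)) (trans eq (α^-%N j)))

    module Subfield {p h : ℕ} (p-prime : Prime p) (q≡p^h : q ≡ p ℕ.^ h) where

      ^q-distrib-+ : ∀ x y → (x + y) ^ q ≈ x ^ q + y ^ q
      ^q-distrib-+ x y = ≡.subst (λ m → (x + y) ^ m ≈ x ^ m + y ^ m) (≡.sym q≡p^h) (^p^e-distrib-+ h x y)
        where
        open Frobenius p-prime (characteristic {p} {h ℕ.* 3} (≡.trans (≡.cong (ℕ._^ 3) q≡p^h) (ℕ.^-*-assoc p h 3)))

      Fq : Carrier → Set ℓ
      Fq x = x ^ q ≈ x

      Fq-cong : ∀ {x y} → x ≈ y → Fq x → Fq y
      Fq-cong x≈y x∈Fq = trans (^-congˡ q (sym x≈y)) (trans x∈Fq x≈y)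

      Fq-0# : Fq 0#
      Fq-0# = zeroˡ _

      Fq-* : ∀ {x y} → Fq x → Fq y → Fq (x * y)
      Fq-* x∈Fq y∈Fq = trans (^-distrib-* _ _ q) (*-cong x∈Fq y∈Fq)

      Fq-+ : ∀ {x y} → Fq x → Fq y → Fq (x + y)
      Fq-+ x∈Fq y∈Fq = trans (^q-distrib-+ _ _) (+-cong x∈Fq y∈Fq)

      Fq-neg : ∀ {x} → Fq x → Fq (- x)
      Fq-neg {x} x∈Fq = trans (inverseʳ-unique _ _ x^q+[-x]^q≈0) (-‿cong x∈Fq)
        where
        x^q+[-x]^q≈0 : x ^ q + (- x) ^ q ≈ 0#
        x^q+[-x]^q≈0 = trans (sym (^q-distrib-+ x (- x))) (trans (^-congˡ q (-‿inverseʳ x)) Fq-0#)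

      Fq-- : ∀ {x y} → Fq x → Fq y → Fq (x - y)
      Fq-- x∈Fq y∈Fq = Fq-+ x∈Fq (Fq-neg y∈Fq)

      Fq-inverse : ∀ {x y} → Fq x → x ≉ 0# → y * x ≈ 1# → Fq y
      Fq-inverse {x} {y} x∈Fq x≉0 yx≈1 = *-cancelˡ x≉0 (begin
        x * y ^ q          ≈⟨ *-comm x _ ⟩
        y ^ q * x          ≈⟨ *-congˡ x∈Fq ⟨
        y ^ q * x ^ q      ≈⟨ ^-distrib-* y x q ⟨
        (y * x) ^ q        ≈⟨ ^-congˡ q yx≈1 ⟩
        1# ^ q             ≈⟨ 1#^ q ⟩
        1#                 ≈⟨ yx≈1 ⟨
        y * x              ≈⟨ *-comm y x ⟩
        x * y              ∎)

      Fq-α^[k*n] : ∀ k → Fq (α ^ (k ℕ.* n))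
      Fq-α^[k*n] k = begin
        (α ^ (k ℕ.* n)) ^ q                  ≈⟨ ^-assocʳ α (k ℕ.* n) q ⟩
        α ^ (k ℕ.* n ℕ.* q)                  ≡⟨ ≡.cong (α ^_) k*n*q≡k*n+k*N ⟩
        α ^ (k ℕ.* n ℕ.+ k ℕ.* N)            ≈⟨ α^-+N (k ℕ.* n) k ⟩
        α ^ (k ℕ.* n)                        ∎
        where
        k*n*q≡k*n+k*N : k ℕ.* n ℕ.* q ≡ k ℕ.* n ℕ.+ k ℕ.* N
        k*n*q≡k*n+k*N = ≡.trans (solve 3 (λ k n m → k :* n :* (con 1 :+ m) := k :* n :+ k :* (m :* n)) ≡.refl k n q₁)
                                (≡.cong (λ m → k ℕ.* n ℕ.+ k ℕ.* m) (≡.sym N≡q₁*n))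

      Fq⇒α^ : ∀ {x} → Fq x → x ≉ 0# → ∃ λ k → k < q₁ × x ≈ α ^ (k ℕ.* n)
      Fq⇒α^ {x} x∈Fq x≉0 with α^-surjective x≉0
      ... | i , i<N , x≈α^i = m , m<q₁ , trans x≈α^i (reflexive (≡.cong (α ^_) i≡m*n))
        where
        α^i*α^[i*q₁]≈α^i*1 : α ^ i * α ^ (i ℕ.* q₁) ≈ α ^ i * 1#
        α^i*α^[i*q₁]≈α^i*1 = begin
          α ^ i * α ^ (i ℕ.* q₁)    ≈⟨ ^-homo-* α i (i ℕ.* q₁) ⟨
          α ^ (i ℕ.+ i ℕ.* q₁)      ≡⟨ ≡.cong (α ^_) (ℕ.*-suc i q₁) ⟨
          α ^ (i ℕ.* q)             ≈⟨ ^-assocʳ α i q ⟨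
          (α ^ i) ^ q               ≈⟨ ^-congˡ q x≈α^i ⟨
          x ^ q                     ≈⟨ x∈Fq ⟩
          x                         ≈⟨ x≈α^i ⟩
          α ^ i                     ≈⟨ *-identityʳ _ ⟨
          α ^ i * 1#                ∎
        N∣i*q₁ : N ∣ i ℕ.* q₁
        N∣i*q₁ = m%n≡0⇒n∣m (i ℕ.* q₁) N (≡.trans (α^≈⇒%N {j = 0} (*-cancelˡ (α^≉0 i) α^i*α^[i*q₁]≈α^i*1))
                                                 (m<n⇒m%n≡m (ℕ.>-nonZero⁻¹ N)))
        m : ℕ
        m = _∣_.quotient N∣i*q₁
        i≡m*n : i ≡ m ℕ.* n
        i≡m*n = ℕ.*-cancelˡ-≡ i (m ℕ.* n) q₁ (≡.trans (ℕ.*-comm q₁ i) (≡.trans (_∣_.equality N∣i*q₁)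
          (≡.trans (≡.cong (m ℕ.*_) N≡q₁*n) (solve 3 (λ c m n → c :* (m :* n) := m :* (c :* n)) ≡.refl m q₁ n))))
        m<q₁ : m < q₁
        m<q₁ = ℕ.*-cancelʳ-< n m q₁ (≡.subst₂ _<_ i≡m*n N≡q₁*n i<N)

      fq : ℕ → Carrier
      fq zero    = 0#
      fq (suc k) = α ^ (k ℕ.* n)

      Fq-fq : ∀ l → Fq (fq l)
      Fq-fq zero    = Fq-0#
      Fq-fq (suc k) = Fq-α^[k*n] k

      fq-injective : ∀ {l l′} → l < q → l′ < q → fq l ≈ fq l′ → l ≡ l′
      fq-injective {zero}  {zero}   _ _ _ = ≡.refl
      fq-injective {zero}  {suc k′} _ _ e = ⊥-elim (α^≉0 (k′ ℕ.* n) (sym e))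
      fq-injective {suc k} {zero}   _ _ e = ⊥-elim (α^≉0 (k ℕ.* n) e)
      fq-injective {suc k} {suc k′} (s≤s k<q₁) (s≤s k′<q₁) e =
        ≡.cong suc (ℕ.*-cancelʳ-≡ k k′ n (α^-injective (k*n<N k<q₁) (k*n<N k′<q₁) e))
        where
        k*n<N : ∀ {k} → k < q₁ → k ℕ.* n < N
        k*n<N {k} k<q₁ = ≡.subst (k ℕ.* n <_) (≡.sym N≡q₁*n) (ℕ.*-monoˡ-< n k<q₁)

      fq-surjective : ∀ {x} → Fq x → ∃ λ l → l < q × fq l ≈ x
      fq-surjective {x} x∈Fq with x ≈? 0#
      ... | yes x≈0 = 0 , s≤s z≤n , sym x≈0
      ... | no x≉0 with Fq⇒α^ x∈Fq x≉0
      ...   | k , k<q₁ , x≈α^[k*n] = suc k , s≤s k<q₁ , sym x≈α^[k*n]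

      module Line (a b : Carrier) (a≉0 : a ≉ 0#) (b∉Fq·a : ∀ λ₀ → InSubfield F q λ₀ → b ≉ λ₀ * a) where

        InSpan : Carrier → Set (c ⊔ ℓ)
        InSpan y = ∃ λ l → ∃ λ m → Fq l × Fq m × y ≈ l * a + m * b

        InSpan-cong : ∀ {y y′} → y ≈ y′ → InSpan y → InSpan y′
        InSpan-cong y≈y′ (l , m , l∈Fq , m∈Fq , y≈) = l , m , l∈Fq , m∈Fq , trans (sym y≈y′) y≈

        InSpan-scale : ∀ {c y} → Fq c → InSpan y → InSpan (c * y)
        InSpan-scale {c} {y} c∈Fq (l , m , l∈Fq , m∈Fq , y≈) = c * l , c * m , Fq-* c∈Fq l∈Fq , Fq-* c∈Fq m∈Fq , (begin
          c * y                      ≈⟨ *-congˡ y≈ ⟩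
          c * (l * a + m * b)        ≈⟨ distribˡ c _ _ ⟩
          c * (l * a) + c * (m * b)  ≈⟨ +-cong (*-assoc c l a) (*-assoc c m b) ⟨
          c * l * a + c * m * b      ∎)

        span-- : ∀ l m l′ m′ → (l * a + m * b) - (l′ * a + m′ * b) ≈ (l - l′) * a + (m - m′) * b
        span-- l m l′ m′ = begin
          (l * a + m * b) - (l′ * a + m′ * b)            ≈⟨ +-congˡ (⁻¹-∙-comm (l′ * a) (m′ * b)) ⟨
          (l * a + m * b) + (- (l′ * a) + - (m′ * b))    ≈⟨ interchange (l * a) (m * b) _ _ ⟩
          (l * a - l′ * a) + (m * b - m′ * b)            ≈⟨ +-cong ([y-z]x≈yx-zx a l l′) ([y-z]x≈yx-zx b m m′) ⟨
          (l - l′) * a + (m - m′) * b                    ∎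

        InSpan-- : ∀ {y y′} → InSpan y → InSpan y′ → InSpan (y - y′)
        InSpan-- (l , m , l∈Fq , m∈Fq , y≈) (l′ , m′ , l′∈Fq , m′∈Fq , y′≈) =
          l - l′ , m - m′ , Fq-- l∈Fq l′∈Fq , Fq-- m∈Fq m′∈Fq , trans (+-cong y≈ (-‿cong y′≈)) (span-- l m l′ m′)

        span-independent : ∀ {l m} → Fq l → Fq m → l * a + m * b ≈ 0# → l ≈ 0# × m ≈ 0#
        span-independent {l} {m} l∈Fq m∈Fq la+mb≈0 with m ≈? 0#
        ... | yes m≈0 = l≈0 , m≈0
          where
          la≈0 : l * a ≈ 0#
          la≈0 = trans (sym (+-identityʳ _)) (trans (+-congˡ (sym (trans (*-congʳ m≈0) (zeroˡ b)))) la+mb≈0)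
          l≈0 : l ≈ 0#
          l≈0 with zero-product la≈0
          ... | inj₁ l≈0 = l≈0
          ... | inj₂ a≈0 = ⊥-elim (a≉0 a≈0)
        ... | no m≉0 with inverseˡ m≉0
        ...   | m⁻¹ , m⁻¹m≈1 = ⊥-elim (b∉Fq·a λ₀ (trans (pow≈^ λ₀ q) λ₀∈Fq) b≈λ₀a)
          where
          λ₀ = - (m⁻¹ * l)
          λ₀∈Fq : Fq λ₀
          λ₀∈Fq = Fq-neg (Fq-* (Fq-inverse m∈Fq m≉0 m⁻¹m≈1) l∈Fq)
          b≈λ₀a : b ≈ λ₀ * a
          b≈λ₀a = begin
            b                      ≈⟨ *-identityˡ b ⟨
            1# * b                 ≈⟨ *-congʳ m⁻¹m≈1 ⟨
            (m⁻¹ * m) * b          ≈⟨ *-assoc m⁻¹ m b ⟩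
            m⁻¹ * (m * b)          ≈⟨ *-congˡ (inverseʳ-unique _ _ la+mb≈0) ⟩
            m⁻¹ * - (l * a)        ≈⟨ -‿distribʳ-* m⁻¹ (l * a) ⟨
            - (m⁻¹ * (l * a))      ≈⟨ -‿cong (*-assoc m⁻¹ l a) ⟨
            - (m⁻¹ * l * a)        ≈⟨ -‿distribˡ-* (m⁻¹ * l) a ⟩
            λ₀ * a                 ∎

        coefficientTest : Carrier → Fin (q ℕ.^ 3) → Fin (q ℕ.^ 3) → Bool
        coefficientTest y i j = isSubfieldB F isF q (enum i) ∧ isSubfieldB F isF q (enum j) ∧ ⌊ y ≈? (enum i * a + enum j * b) ⌋

        inSpanB⇒InSpan : ∀ y → T (inSpanB F isF q a b y) → InSpan y
        inSpanB⇒InSpan y t with anyFin⁻ (λ i → anyFin (coefficientTest y i)) t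
        ... | i , tᵢ with anyFin⁻ (coefficientTest y i) tᵢ
        ...   | j , tᵢⱼ with Equivalence.to T-∧ tᵢⱼ
        ...     | i∈Fq , rest with Equivalence.to T-∧ rest
        ...       | j∈Fq , y≈ = enum i , enum j , toFq i∈Fq , toFq j∈Fq , toWitness y≈
          where
          toFq : ∀ {x} → T (isSubfieldB F isF q x) → Fq x
          toFq {x} x∈Fq = trans (sym (pow≈^ x q)) (toWitness x∈Fq)

        InSpan⇒inSpanB : ∀ y → InSpan y → T (inSpanB F isF q a b y)
        InSpan⇒inSpanB y (l , m , l∈Fq , m∈Fq , y≈) =
          anyFin⁺ (λ i → anyFin (coefficientTest y i)) (code l) (anyFin⁺ (coefficientTest y (code l)) (code m) (Equivalence.from T-∧ (fromFq l∈Fq ,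
            Equivalence.from T-∧ (fromFq m∈Fq , fromWitness (trans y≈ (sym (+-cong (*-congʳ (decode l)) (*-congʳ (decode m)))))))))
          where
          code : Carrier → Fin (q ℕ.^ 3)
          code x = proj₁ (enum-surj x)
          decode : ∀ x → enum (code x) ≈ x
          decode x = proj₂ (enum-surj x)
          fromFq : ∀ {x} → Fq x → T (isSubfieldB F isF q (enum (code x)))
          fromFq {x} x∈Fq = fromWitness (trans (pow≈^ _ q) (Fq-cong (sym (decode x)) x∈Fq))

        -- Kept opaque: normalising onLineB unfolds a search over all pairs of field elements.
        opaque
          onLine : ℕ → Bool
          onLine = onLineB F isF q α a b

          onLine≡onLineB : ∀ i → onLine i ≡ onLineB F isF q α a b i
          onLine≡onLineB i = ≡.refl

          onLine⇒InSpan : ∀ {i} → T (onLine i) → InSpan (α ^ i)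
          onLine⇒InSpan {i} t = InSpan-cong (pow≈^ α i) (inSpanB⇒InSpan _ t)

          InSpan⇒onLine : ∀ {i} → InSpan (α ^ i) → T (onLine i)
          InSpan⇒onLine {i} s = InSpan⇒inSpanB _ (InSpan-cong (sym (pow≈^ α i)) s)

        onLine-scale : ∀ {i j c} → Fq c → c ≉ 0# → α ^ j ≈ c * α ^ i → onLine i ≡ onLine j
        onLine-scale {i} {j} {c} c∈Fq c≉0 α^j≈cα^i with inverseˡ c≉0
        ... | c⁻¹ , c⁻¹c≈1 = T-injective
          (λ i∈ℓ → InSpan⇒onLine {j} (InSpan-cong (sym α^j≈cα^i) (InSpan-scale c∈Fq (onLine⇒InSpan {i} i∈ℓ))))
          (λ j∈ℓ → InSpan⇒onLine {i} (InSpan-cong c⁻¹α^j≈α^i (InSpan-scale (Fq-inverse c∈Fq c≉0 c⁻¹c≈1) (onLine⇒InSpan {j} j∈ℓ))))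
          where
          c⁻¹α^j≈α^i : c⁻¹ * α ^ j ≈ α ^ i
          c⁻¹α^j≈α^i = begin
            c⁻¹ * α ^ j          ≈⟨ *-congˡ α^j≈cα^i ⟩
            c⁻¹ * (c * α ^ i)    ≈⟨ *-assoc c⁻¹ c _ ⟨
            (c⁻¹ * c) * α ^ i    ≈⟨ *-congʳ c⁻¹c≈1 ⟩
            1# * α ^ i           ≈⟨ *-identityˡ _ ⟩
            α ^ i                ∎

        onLine-+n : ∀ i → onLine (n ℕ.+ i) ≡ onLine i
        onLine-+n i = ≡.sym (onLine-scale {i} {n ℕ.+ i} (Fq-cong (reflexive (≡.cong (α ^_) (ℕ.*-identityˡ n))) (Fq-α^[k*n] 1))
                                          (α^≉0 n) (^-homo-* α n i))

        onLine-%n : ∀ i → onLine i ≡ onLine (i % n)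
        onLine-%n i = ≡.trans (≡.cong onLine (m≡m%n+[m/n]*n i n)) (periodic (i / n))
          where
          periodic : ∀ k → onLine (i % n ℕ.+ k ℕ.* n) ≡ onLine (i % n)
          periodic k = ≡.sym (onLine-scale {i % n} {i % n ℕ.+ k ℕ.* n} (Fq-α^[k*n] k) (α^≉0 (k ℕ.* n))
                                           (trans (^-homo-* α (i % n) (k ℕ.* n)) (*-comm _ _)))

        point : Fin q → Fin q → Carrier
        point l m = fq (toℕ l) * a + fq (toℕ m) * b

        InSpan-point : ∀ l m → InSpan (point l m)
        InSpan-point l m = fq (toℕ l) , fq (toℕ m) , Fq-fq (toℕ l) , Fq-fq (toℕ m) , refl

        point-injective : ∀ {l m l′ m′} → point l m - point l′ m′ ≈ 0# → l ≡ l′ × m ≡ m′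
        point-injective {l} {m} {l′} {m′} difference≈0
          with span-independent (Fq-- (Fq-fq (toℕ l)) (Fq-fq (toℕ l′))) (Fq-- (Fq-fq (toℕ m)) (Fq-fq (toℕ m′)))
                 (trans (sym (span-- _ _ _ _)) difference≈0)
        ... | Δl≈0 , Δm≈0 = same l l′ Δl≈0 , same m m′ Δm≈0
          where
          same : ∀ k k′ → fq (toℕ k) - fq (toℕ k′) ≈ 0# → k ≡ k′
          same k k′ Δ≈0 = Fin.toℕ-injective (fq-injective (Fin.toℕ<n k) (Fin.toℕ<n k′) (x∙y⁻¹≈ε⇒x≈y _ _ Δ≈0))

        point-surjective : ∀ {y} → InSpan y → ∃ λ l → ∃ λ m → y ≈ point l m
        point-surjective (l , m , l∈Fq , m∈Fq , y≈) with fq-surjective l∈Fq | fq-surjective m∈Fq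
        ... | k , k<q , fqk≈l | k′ , k′<q , fqk′≈m = fromℕ< k<q , fromℕ< k′<q ,
          trans y≈ (sym (+-cong (*-congʳ (trans (reflexive (≡.cong fq (Fin.toℕ-fromℕ< k<q))) fqk≈l))
                                (*-congʳ (trans (reflexive (≡.cong fq (Fin.toℕ-fromℕ< k′<q))) fqk′≈m))))

        point-code : Fin q → Fin q → ℕ
        point-code l m = toℕ (combine l m)

        point-code<q*q : ∀ l m → point-code l m < q ℕ.* q
        point-code<q*q l m = Fin.toℕ<n (combine l m)

        point-code-injective : ∀ {l m l′ m′} → point-code l m ≡ point-code l′ m′ → l ≡ l′ × m ≡ m′
        point-code-injective eq = Fin.combine-injective _ _ _ _ (Fin.toℕ-injective eq)

        point-code≡0 : ∀ {l m} → point-code l m ≡ 0 → point l m ≈ 0#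
        point-code≡0 {l} {m} code≡0 = begin
          fq (toℕ l) * a + fq (toℕ m) * b  ≡⟨ ≡.cong₂ (λ i j → fq i * a + fq j * b) l≡0 m≡0 ⟩
          0# * a + 0# * b                  ≈⟨ +-cong (zeroˡ a) (zeroˡ b) ⟩
          0# + 0#                          ≈⟨ +-identityʳ 0# ⟩
          0#                               ∎
          where
          q*l+m≡0 : q ℕ.* toℕ l ℕ.+ toℕ m ≡ 0
          q*l+m≡0 = ≡.trans (≡.sym (Fin.toℕ-combine l m)) code≡0
          m≡0 : toℕ m ≡ 0
          m≡0 = ℕ.m+n≡0⇒n≡0 (q ℕ.* toℕ l) q*l+m≡0
          l≡0 : toℕ l ≡ 0
          l≡0 = ℕ.*-cancelˡ-≡ (toℕ l) 0 q (≡.trans (ℕ.m+n≡0⇒m≡0 (q ℕ.* toℕ l) q*l+m≡0) (≡.sym (ℕ.*-zeroʳ q)))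

        coordinates : ∀ i → onLine i ≡ true → ∃ λ l → ∃ λ m → α ^ i ≈ point l m
        coordinates i i∈ℓ = point-surjective (onLine⇒InSpan {i} (Equivalence.from T-≡ i∈ℓ))

        row col : ∀ i → onLine i ≡ true → Fin q
        row i i∈ℓ = proj₁ (coordinates i i∈ℓ)
        col i i∈ℓ = proj₁ (proj₂ (coordinates i i∈ℓ))

        α^≈point : ∀ i i∈ℓ → α ^ i ≈ point (row i i∈ℓ) (col i i∈ℓ)
        α^≈point i i∈ℓ = proj₂ (proj₂ (coordinates i i∈ℓ))

        count-onLine<N : count N onLine ≤ q ℕ.* q ℕ.∸ 1
        count-onLine<N = ℕ.≤-trans (count-injection N (q ℕ.* q) onLine (λ v → not ⌊ v ℕ.≟ 0 ⌋) code maps injective)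
                                   (ℕ.≤-reflexive (count-≢ (q ℕ.* q) (s≤s z≤n)))
          where
          code : ∀ i → onLine i ≡ true → ℕ
          code i i∈ℓ = point-code (row i i∈ℓ) (col i i∈ℓ)
          maps : ∀ i → i < N → (i∈ℓ : onLine i ≡ true) → code i i∈ℓ < q ℕ.* q × not ⌊ code i i∈ℓ ℕ.≟ 0 ⌋ ≡ true
          maps i _ i∈ℓ = point-code<q*q (row i i∈ℓ) (col i i∈ℓ) , ≡.cong not (⌊≟⌋-≢ (λ code≡0 →
            α^≉0 i (trans (α^≈point i i∈ℓ) (point-code≡0 {row i i∈ℓ} {col i i∈ℓ} code≡0))))
          injective : ∀ i j → i < N → j < N → (i∈ℓ : onLine i ≡ true) (j∈ℓ : onLine j ≡ true) → code i i∈ℓ ≡ code j j∈ℓ → i ≡ j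
          injective i j i<N j<N i∈ℓ j∈ℓ eq with point-code-injective {row i i∈ℓ} {col i i∈ℓ} {row j j∈ℓ} {col j j∈ℓ} eq
          ... | l≡l′ , m≡m′ = α^-injective i<N j<N
            (trans (α^≈point i i∈ℓ) (trans (reflexive (≡.cong₂ point l≡l′ m≡m′)) (sym (α^≈point j j∈ℓ))))

        count-onLine≤q+1 : count n onLine ≤ q ℕ.+ 1
        count-onLine≤q+1 = ℕ.*-cancelˡ-≤ q₁ (ℕ.≤-trans (ℕ.≤-reflexive q₁*count≡count) (ℕ.≤-trans count-onLine<N
                                                    (ℕ.≤-reflexive q*q-1≡q₁*[q+1])))
          where
          q₁*count≡count : q₁ ℕ.* count n onLine ≡ count N onLine
          q₁*count≡count = ≡.trans (≡.sym (count-* q₁ n onLine-+n)) (≡.cong (λ m → count m onLine) (≡.sym N≡q₁*n))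
          q*q-1≡q₁*[q+1] : q ℕ.* q ℕ.∸ 1 ≡ q₁ ℕ.* (q ℕ.+ 1)
          q*q-1≡q₁*[q+1] = solve 1 (λ m → m :+ m :* (con 1 :+ m) := m :* ((con 1 :+ m) :+ con 1)) ≡.refl q₁

        Good : ℕ → Set
        Good δ = ∃ λ x → x < n × onLine x ≡ true × onLine ((x ℕ.+ δ) % n) ≡ true

        good-from-ratio : ∀ {δ X Y} → InSpan X → InSpan Y → X ≉ 0# → X ≈ α ^ δ * Y → Good δ
        good-from-ratio {δ} {X} {Y} X∈span Y∈span X≉0 X≈α^δY
          with α^-surjective X≉0 | α^-surjective Y≉0
          where Y≉0 = λ Y≈0 → X≉0 (trans X≈α^δY (trans (*-congˡ Y≈0) (zeroʳ _)))
        ... | i , _ , X≈α^i | j , _ , Y≈α^j =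
          j % n , m%n<n j n , ≡.trans (≡.sym (onLine-%n j)) (on j Y≈α^j Y∈span) ,
          ≡.trans (≡.cong onLine [j%n+δ]%n≡i%n) (≡.trans (≡.sym (onLine-%n i)) (on i X≈α^i X∈span))
          where
          on : ∀ k {Z} → Z ≈ α ^ k → InSpan Z → onLine k ≡ true
          on k Z≈α^k Z∈span = Equivalence.to T-≡ (InSpan⇒onLine {k} (InSpan-cong Z≈α^k Z∈span))
          i%N≡[δ+j]%N : i % N ≡ (δ ℕ.+ j) % N
          i%N≡[δ+j]%N = α^≈⇒%N (trans (sym X≈α^i) (trans X≈α^δY (trans (*-congˡ Y≈α^j) (sym (^-homo-* α δ j)))))
          n∣N : n ∣ N
          n∣N = divides q₁ N≡q₁*n
          [j%n+δ]%n≡i%n : (j % n ℕ.+ δ) % n ≡ i % n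
          [j%n+δ]%n≡i%n = ≡.trans (%-distribˡ-+ (j % n) δ n) (≡.trans (≡.cong (λ z → (z ℕ.+ δ % n) % n) (m%n%n≡m%n j n))
            (≡.trans (≡.sym (%-distribˡ-+ j δ n)) (≡.trans (≡.cong (_% n) (ℕ.+-comm j δ))
            (≡.trans (≡.sym (m∣n⇒o%n%m≡o%m n N (δ ℕ.+ j) n∣N)) (≡.trans (≡.cong (_% n) (≡.sym i%N≡[δ+j]%N))
            (m∣n⇒o%n%m≡o%m n N i n∣N))))))

        pair : Fin (q ℕ.* q) → Carrier
        pair k = point (proj₁ (remQuot {q} q k)) (proj₂ (remQuot {q} q k))

        InSpan-pair : ∀ k → InSpan (pair k)
        InSpan-pair k = InSpan-point (proj₁ (remQuot {q} q k)) (proj₂ (remQuot {q} q k))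

        pair-injective : ∀ k k′ → pair k - pair k′ ≈ 0# → k ≡ k′
        pair-injective k k′ difference≈0
          with point-injective {proj₁ (remQuot {q} q k)} {proj₂ (remQuot {q} q k)}
                               {proj₁ (remQuot {q} q k′)} {proj₂ (remQuot {q} q k′)} difference≈0
        ... | l≡l′ , m≡m′ = ≡.trans (≡.sym (Fin.combine-remQuot {q} q k))
                              (≡.trans (≡.cong₂ combine l≡l′ m≡m′) (Fin.combine-remQuot {q} q k′))

        q³<q⁴ : suc N < (q ℕ.* q) ℕ.* (q ℕ.* q)
        q³<q⁴ = ≡.subst₂ _<_ (≡.trans (ℕ.*-identityʳ _) q³≡1+N)
                             (solve 1 (λ m → (m :* (m :* (m :* con 1))) :* m := (m :* m) :* (m :* m)) ≡.refl q)
                             (ℕ.*-monoʳ-< (q ℕ.^ 3) (s≤s (s≤s z≤n)))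
          where instance _ = ℕ.m^n≢0 q 3

        every-difference : ∀ δ → Good δ
        every-difference δ with Fin.any? {n = n} (λ x → T? (onLine (toℕ x) ∧ onLine ((toℕ x ℕ.+ δ) % n)))
        ... | yes (x , good) with Equivalence.to T-∧ good
        ...   | x∈ℓ , x+δ∈ℓ = toℕ x , Fin.toℕ<n x , Equivalence.to T-≡ x∈ℓ , Equivalence.to T-≡ x+δ∈ℓ
        every-difference δ | no ¬good = ⊥-elim (Fin.<⇒notInjective {f = f} q³<q⁴ f-injective)
          where
          difference : Fin ((q ℕ.* q) ℕ.* (q ℕ.* q)) → Carrier
          difference k = pair (proj₁ (remQuot {q ℕ.* q} (q ℕ.* q) k)) - α ^ δ * pair (proj₂ (remQuot {q ℕ.* q} (q ℕ.* q) k))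
          f : Fin ((q ℕ.* q) ℕ.* (q ℕ.* q)) → Fin (suc N)
          f k = fromℕ< (index<1+N (difference k))
          no-good : ¬ Good δ
          no-good (x , x<n , x∈ℓ , x+δ∈ℓ) = ¬good (fromℕ< x<n , ≡.subst (λ z → T (onLine z ∧ onLine ((z ℕ.+ δ) % n)))
            (≡.sym (Fin.toℕ-fromℕ< x<n)) (Equivalence.from T-∧ (Equivalence.from T-≡ x∈ℓ , Equivalence.from T-≡ x+δ∈ℓ)))
          module _ (k k′ : Fin ((q ℕ.* q) ℕ.* (q ℕ.* q))) (eq : difference k ≈ difference k′) where
            u  = proj₁ (remQuot {q ℕ.* q} (q ℕ.* q) k)
            v  = proj₂ (remQuot {q ℕ.* q} (q ℕ.* q) k)
            u′ = proj₁ (remQuot {q ℕ.* q} (q ℕ.* q) k′)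
            v′ = proj₂ (remQuot {q ℕ.* q} (q ℕ.* q) k′)
            X = pair u - pair u′
            Y = pair v - pair v′

            X≈α^δY : X ≈ α ^ δ * Y
            X≈α^δY = x∙y⁻¹≈ε⇒x≈y X (α ^ δ * Y) (begin
              X - α ^ δ * Y                                         ≈⟨ +-congˡ (-‿cong (x[y-z]≈xy-xz (α ^ δ) (pair v) (pair v′))) ⟩
              X - (α ^ δ * pair v - α ^ δ * pair v′)                ≈⟨ [x-y]-[u-v]≈[x-u]-[y-v] _ _ _ _ ⟨
              difference k - difference k′                          ≈⟨ x≈y⇒x∙y⁻¹≈ε eq ⟩
              0#                                                    ∎)

            difference-injective : k ≡ k′
            difference-injective with X ≈? 0#
            ... | no X≉0  = ⊥-elim (no-good (good-from-ratio (InSpan-- (InSpan-pair u) (InSpan-pair u′))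
                                                             (InSpan-- (InSpan-pair v) (InSpan-pair v′)) X≉0 X≈α^δY))
            ... | yes X≈0 with zero-product (trans (sym X≈α^δY) X≈0)
            ...   | inj₁ α^δ≈0 = ⊥-elim (α^≉0 δ α^δ≈0)
            ...   | inj₂ Y≈0   = ≡.trans (≡.sym (Fin.combine-remQuot {q ℕ.* q} (q ℕ.* q) k))
                                   (≡.trans (≡.cong₂ combine (pair-injective u u′ X≈0) (pair-injective v v′ Y≈0))
                                            (Fin.combine-remQuot {q ℕ.* q} (q ℕ.* q) k′))
          f-injective : Injective _≡_ _≡_ f
          f-injective {k} {k′} fk≡fk′ = difference-injective k k′ (index-injective
            (≡.trans (≡.sym (Fin.toℕ-fromℕ< _)) (≡.trans (≡.cong toℕ fk≡fk′) (Fin.toℕ-fromℕ< _))))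

open import Algebra.Bundles using (CommutativeRing)
open import Data.Bool using (true; _∧_)
open import Data.Nat
open import Data.Nat.Properties
open import Data.Nat.DivMod using (_%_; m%n<n; m∣n⇒o%n%m≡o%m; m<n⇒m%n≡m)
open import Data.Nat.Divisibility using (_∣_; divides; ∣-trans; ∣1⇒≡1; ∣m+n∣m⇒∣n; ∣m∣n⇒∣m+n; ∣m⇒∣m*n; m∣m*n)
open import Data.Nat.Coprimality using (Coprime; coprime-divisor)
open import Data.Nat.Primality using (Prime; prime⇒nonTrivial; ¬prime[0]; ¬prime[1])
open import Data.Nat.Solver using (module +-*-Solver)
open import Data.Fin using (Fin)
open import Data.Product using (∃; _×_; _,_)
open import Data.Empty using (⊥-elim)
open import Relation.Nullary using (¬_)
open import Relation.Nullary.Decidable using (⌊_⌋)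
open import Relation.Binary.PropositionalEquality
open import Defs
open FiniteSums
open Counting
open ModularArithmetic
open DifferenceSets
open MultiplicativeOrbits
open ProjectivePlane
open +-*-Solver using (solve; _:+_; _:*_; _:=_; con)

∣q⇒∣q²+q+1⇒≡1 : ∀ {d q} → d ∣ q → d ∣ q * q + q + 1 → d ≡ 1
∣q⇒∣q²+q+1⇒≡1 {d} {q} d∣q d∣q²+q+1 = ∣1⇒≡1 (∣m+n∣m⇒∣n d∣q²+q+1 (∣m∣n⇒∣m+n (∣m⇒∣m*n q d∣q) d∣q))

module WeightIdentities {c ℓ} (p h q₂ t₁ : ℕ) (p-prime : Prime p) (1≤h : 1 ≤ h) (q≡p^h : suc (suc q₂) ≡ p ^ h)
  (t-prime : Prime (suc t₁)) (t∣q²+q+1 : suc t₁ ∣ suc (suc q₂) * suc (suc q₂) + suc (suc q₂) + 1)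
  (F : CommutativeRing c ℓ) (isF : IsFieldOfOrder F (suc (suc q₂) ^ 3))
  (α : CommutativeRing.Carrier F) (α-primitive : IsPrimitive F (suc (suc q₂) ^ 3) α)
  (a b : CommutativeRing.Carrier F) (a≉0 : ¬ CommutativeRing._≈_ F a (CommutativeRing.0# F))
  (b∉Fq·a : ∀ λ₀ → InSubfield F (suc (suc q₂)) λ₀ → ¬ CommutativeRing._≈_ F b (CommutativeRing._*_ F λ₀ a))
  (τ-invariant : ∀ i → i < suc (suc q₂) * suc (suc q₂) + suc (suc q₂) + 1 →
    onLineB F isF (suc (suc q₂)) α a b ((i * p) % suc (suc (suc q₂) * suc (suc q₂) + suc (suc q₂)))
      ≡ onLineB F isF (suc (suc q₂)) α a b i)
  (reps : Fin (sOrb p (suc t₁)) → ℕ)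
  (reps-range : ∀ j → 1 ≤ reps j × reps j < suc t₁)
  (reps-distinct : ∀ j k → SameOrbit p (suc t₁) (reps j) (reps k) → j ≡ k)
  (reps-cover : ∀ u → 1 ≤ u → u < suc t₁ → ∃ λ j → SameOrbit p (suc t₁) (reps j) u) where

  open SingerCycle F q₂ isF α α-primitive using (q; n)
  open SingerCycle.Subfield F q₂ isF α α-primitive {p} {h} p-prime q≡p^h
  open Line a b a≉0 b∉Fq·a using (onLine; onLine≡onLineB; every-difference; count-onLine≤q+1)

  t s : ℕ
  t = suc t₁
  s = sOrb p t

  q*q+q+1≡n : q * q + q + 1 ≡ n
  q*q+q+1≡n = +-comm (q * q + q) 1

  d : ℕ
  d = _∣_.quotient t∣q²+q+1

  t*d≡n : t * d ≡ n
  t*d≡n = trans (*-comm t d) (trans (sym (_∣_.equality t∣q²+q+1)) q*q+q+1≡n)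

  t∣n : t ∣ n
  t∣n = divides d (trans (sym t*d≡n) (*-comm t d))

  open PerfectDifferenceSet q onLine using (module Residues)
  open Residues (s≤s z≤n) (λ δ _ _ → every-difference δ) count-onLine≤q+1 t₁ d t*d≡n
    using (classWeight; sumBelow-classWeight; sumBelow-classWeight²)

  weight≡classWeight : ∀ u → weight F isF q t α a b u ≡ classWeight u
  weight≡classWeight u = trans (cong (λ m → count m (λ i → onLineB F isF q α a b i ∧ ⌊ i % t ≟ u ⌋)) q*q+q+1≡n)
                    (count-cong n (λ i _ → cong (_∧ ⌊ i % t ≟ u ⌋) (sym (onLine≡onLineB i))))

  p∣q : p ∣ q
  p∣q = subst (p ∣_) (sym q≡p^h) (p∣p^h h 1≤h)
    where
    p∣p^h : ∀ h → 1 ≤ h → p ∣ p ^ h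
    p∣p^h (suc h) _ = m∣m*n (p ^ h)

  n-coprime-p : Coprime n p
  n-coprime-p {e} (e∣n , e∣p) = ∣q⇒∣q²+q+1⇒≡1 (∣-trans e∣p p∣q) (subst (e ∣_) (sym q*q+q+1≡n) e∣n)

  t∤p : ¬ t ∣ p
  t∤p t∣p = <-irrefl (sym (∣q⇒∣q²+q+1⇒≡1 (∣-trans t∣p p∣q) t∣q²+q+1)) (nonTrivial⇒n>1 t {{prime⇒nonTrivial t-prime}})

  onLine-τ : ∀ i → i < n → onLine ((i * p) % n) ≡ onLine i
  onLine-τ i i<n = trans (onLine≡onLineB _) (trans (τ-invariant i (subst (i <_) (sym q*q+q+1≡n) i<n))
                                                   (sym (onLine≡onLineB i)))

  classWeight≤classWeight-τ : ∀ u → u < t → classWeight u ≤ classWeight ((u * p) % t)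
  classWeight≤classWeight-τ u u<t =
    count-injection n n (λ i → onLine i ∧ ⌊ i % t ≟ u ⌋) (λ i → onLine i ∧ ⌊ i % t ≟ (u * p) % t ⌋)
                    (λ i _ → (i * p) % n) maps injective
    where
    maps : ∀ i → i < n → (onLine i ∧ ⌊ i % t ≟ u ⌋) ≡ true →
           (i * p) % n < n × (onLine ((i * p) % n) ∧ ⌊ (i * p) % n % t ≟ (u * p) % t ⌋) ≡ true
    maps i i<n i∈class with ∧≡true⇒ i∈class
    ... | i∈ℓ , i%t≡u = m%n<n (i * p) n , ∧≡true⇐ (trans (onLine-τ i i<n) i∈ℓ) (≡⇒⌊≟⌋≡true (begin
      (i * p) % n % t       ≡⟨ m∣n⇒o%n%m≡o%m t n (i * p) t∣n ⟩
      (i * p) % t           ≡⟨ %-*-%ˡ t i p ⟨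
      (i % t * p) % t       ≡⟨ cong (λ z → (z * p) % t) (⌊≟⌋≡true⇒≡ i%t≡u) ⟩
      (u * p) % t           ∎))
      where open ≡-Reasoning
    injective : ∀ i j → i < n → j < n → _ → _ → (i * p) % n ≡ (j * p) % n → i ≡ j
    injective i j i<n j<n _ _ eq = trans (sym (m<n⇒m%n≡m i<n)) (trans (%-cancelˡ-* n p (λ z → coprime-divisor n-coprime-p)
      (trans (cong (_% n) (*-comm p i)) (trans eq (cong (_% n) (*-comm j p))))) (m<n⇒m%n≡m j<n))

  open PowerOrbits p t₁ t-prime t∤p using (Invariant; ≤-invariant⇒invariant; module Representatives)
  open Representatives s reps reps-range reps-distinct reps-cover using (orbit-decomposition)

  classWeight-invariant : Invariant classWeight
  classWeight-invariant = ≤-invariant⇒invariant classWeight≤classWeight-τ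

  orbit-moment : ∀ {g} → Invariant g → ∀ {m} → sumBelow t g ≡ m → s * g 0 + t₁ * finSum (λ j → g (reps j)) ≡ s * m
  orbit-moment {g} invariant {m} sum≡m = begin
    s * g 0 + t₁ * finSum (λ j → g (reps j))     ≡⟨ cong (s * g 0 +_) (orbit-decomposition invariant) ⟨
    s * g 0 + s * sumBelow t₁ (λ i → g (suc i))  ≡⟨ *-distribˡ-+ s (g 0) _ ⟨
    s * (g 0 + sumBelow t₁ (λ i → g (suc i)))    ≡⟨ cong (s *_) (trans (sym (sumBelow-suc t₁ g)) sum≡m) ⟩
    s * m                                        ∎
    where open ≡-Reasoning

  W : ℕ → ℕ
  W = weight F isF q t α a b

  first-moment : s * W 0 + t₁ * finSum (λ j → W (reps j)) ≡ s * (q + 1)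
  first-moment = trans (cong₂ (λ x y → s * x + t₁ * y) (weight≡classWeight 0) (finSum-cong s (λ j → weight≡classWeight (reps j))))
                       (orbit-moment classWeight-invariant sumBelow-classWeight)

  second-moment : t * (s * (W 0 * W 0) + t₁ * finSum (λ j → W (reps j) * W (reps j))) ≡ s * (q * q + (t + 1) * q + 1)
  second-moment = begin
    t * (s * (W 0 * W 0) + t₁ * finSum (λ j → W (reps j) * W (reps j)))
      ≡⟨ cong (t *_) (cong₂ (λ x y → s * x + t₁ * y) (square≡ 0) (finSum-cong s (λ j → square≡ (reps j)))) ⟩
    t * (s * (classWeight 0 * classWeight 0) + t₁ * finSum (λ j → classWeight (reps j) * classWeight (reps j)))
      ≡⟨ cong (t *_) (orbit-moment (λ u u<t → cong₂ _*_ (classWeight-invariant u u<t) (classWeight-invariant u u<t))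
                                   sumBelow-classWeight²) ⟩
    t * (s * (q + d))
      ≡⟨ solve 3 (λ t s x → t :* (s :* x) := s :* (t :* x)) refl t s (q + d) ⟩
    s * (t * (q + d))
      ≡⟨ cong (s *_) t*[q+d]≡ ⟩
    s * (q * q + (t + 1) * q + 1) ∎
    where
    open ≡-Reasoning
    square≡ : ∀ u → W u * W u ≡ classWeight u * classWeight u
    square≡ u = cong₂ _*_ (weight≡classWeight u) (weight≡classWeight u)
    t*[q+d]≡ : t * (q + d) ≡ q * q + (t + 1) * q + 1
    t*[q+d]≡ = begin
      t * (q + d)                   ≡⟨ *-distribˡ-+ t q d ⟩
      t * q + t * d                 ≡⟨ cong (t * q +_) (trans t*d≡n (sym q*q+q+1≡n)) ⟩
      t * q + (q * q + q + 1)       ≡⟨ solve 2 (λ t q → t :* q :+ (q :* q :+ q :+ con 1) := q :* q :+ (t :+ con 1) :* q :+ con 1) refl t q ⟩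
      q * q + (t + 1) * q + 1       ∎

2≤p^h : ∀ {p h} → Prime p → 1 ≤ h → 2 ≤ p ^ h
2≤p^h {p} {suc h} p-prime _ = ≤-trans 2≤p (m≤m*n p (p ^ h))
  where
  2≤p = nonTrivial⇒n>1 p {{prime⇒nonTrivial p-prime}}
  instance _ = m^n≢0 p h {{>-nonZero (≤-trans (s≤s z≤n) 2≤p)}}

corollary2 : ∀ {c ℓ} (p h q t : ℕ) → Prime p → 1 ≤ h → q ≡ p ^ h →
    Prime t → t ∣ (q * q + q + 1) →
    (F : CommutativeRing c ℓ) (isF : IsFieldOfOrder F (q ^ 3)) →
    (α : CommutativeRing.Carrier F) → IsPrimitive F (q ^ 3) α →
    (a b : CommutativeRing.Carrier F) →
    ¬ (CommutativeRing._≈_ F a (CommutativeRing.0# F)) →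
    (∀ λ₀ → InSubfield F q λ₀ → ¬ (CommutativeRing._≈_ F b (CommutativeRing._*_ F λ₀ a))) →
    (∀ i → i < q * q + q + 1 →
      onLineB F isF q α a b ((i * p) % suc (q * q + q)) ≡ onLineB F isF q α a b i) →
    (reps : Fin (sOrb p t) → ℕ) →
    (∀ j → 1 ≤ reps j × reps j < t) →
    (∀ j k → SameOrbit p t (reps j) (reps k) → j ≡ k) →
    (∀ u → 1 ≤ u → u < t → ∃ λ j → SameOrbit p t (reps j) u) →
    let w = weight F isF q t α a b
        s = sOrb p t
    in (s * w 0 + (t ∸ 1) * finSum (λ j → w (reps j)) ≡ s * (q + 1))
     × (t * (s * (w 0 * w 0) + (t ∸ 1) * finSum (λ j → w (reps j) * w (reps j)))
          ≡ s * (q * q + (t + 1) * q + 1))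
corollary2 p h zero t p-prime 1≤h q≡p^h with subst (2 ≤_) (sym q≡p^h) (2≤p^h p-prime 1≤h)
... | ()
corollary2 p h (suc zero) t p-prime 1≤h q≡p^h with subst (2 ≤_) (sym q≡p^h) (2≤p^h p-prime 1≤h)
... | s≤s ()
corollary2 p h (suc (suc q₂)) zero          _ _ _ t-prime = ⊥-elim (¬prime[0] t-prime)
corollary2 p h (suc (suc q₂)) (suc zero)    _ _ _ t-prime = ⊥-elim (¬prime[1] t-prime)
corollary2 p h (suc (suc q₂)) (suc (suc t₀)) p-prime 1≤h q≡p^h t-prime t∣q²+q+1 F isF α α-primitive a b a≉0 b∉Fq·a
           τ-invariant reps reps-range reps-distinct reps-cover = first-moment , second-moment
  where open WeightIdentities p h q₂ (suc t₀) p-prime 1≤h q≡p^h t-prime t∣q²+q+1 F isF α α-primitive a b a≉0 b∉Fq·a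
                              τ-invariant reps reps-range reps-distinct reps-cover
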